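{- Let $\Lambda(z)=\sum_{n\ge1}\lambda_nz^n$, where $\lambda_n$ is the number of closed lambda-terms of size $n$. Let $C(z)=(1-\sqrt{1-4z^2})/2$ and let $\tilde\Lambda(z)$ be the formal power series solution of $$\tilde\Lambda(z)=C(z)+z\tilde\Lambda(z)^2+z\tilde\Lambda\!\left(\frac{z}{1-2C(z)}\right)-z\tilde\Lambda(z).$$ Then $\Lambda(z)=\tilde\Lambda\!\left(\frac{z}{1-z}\right)$. Moreover, $$\Lambda(z)=zM(z,1)+z\Lambda(z)^2+z\Lambda\!\left(\frac{z}{1-2zM(z,1)}\right),$$ where $M(z,1)=\frac{1-z-\sqrt{(1-z)^2-4z^2}}{2z}$ is the generating function of Motzkin trees counted by number of nodes.
   Context: Lambda-terms are generated by the grammar $T::=x\mid (T*T)\mid \lambda x.T$; an abstraction $\lambda x.T$ binds the free occurrences of $x$ in $T$; a term is closed if no variable occurrence is free. Terms are counted up to renaming of bound variables (only the binding structure matters). Equivalently a closed lambda-term is a Motzkin tree (rooted plane tree with nodes of 0, 1 or 2 ordered children; applications = binary nodes, abstractions = unary nodes, variable occurrences = leaves) with, for each leaf, a pointer from exactly one unary ancestor. Size: $|x|=1$, $|\lambda x.T|=1+|T|$, $|(S*T)|=1+|S|+|T|$ (total number of nodes). $C(z)$ is the generating function (by number of nodes) of binary trees with an extra unary root node. -}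

module Defs where

open import Data.Nat as ℕ using (ℕ; zero; suc; _∸_)
open import Data.Integer using (+_)
open import Data.Fin using (Fin)
open import Data.List using (List; []; _∷_; _++_; length)
open import Data.Rational using (ℚ; 0ℚ; 1ℚ; ½; _+_; _*_; -_; _-_; _/_)
open import Relation.Binary.PropositionalEquality using (_≡_)

-- Closed lambda-terms, counted up to renaming of bound variables.
-- We use de Bruijn indices: Term k = terms whose free variables lie
-- among k enclosing binders; closed terms are Term 0.  (This is exactly
-- a Motzkin tree with, for each leaf, a pointer to one unary ancestor.)

data Term : ℕ → Set where
  var : ∀ {k} → Fin k → Term k
  app : ∀ {k} → Term k → Term k → Term k
  lam : ∀ {k} → Term (suc k) → Term k

size : ∀ {k} → Term k → ℕ
size (var _)   = 1
size (app s t) = suc (size s ℕ.+ size t)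
size (lam t)   = suc (size t)

ClosedOfSize : ℕ → Set
ClosedOfSize n = Data.Product.Σ (Term 0) (λ t → size t ≡ n)
  where import Data.Product

Series : Set
Series = ℕ → ℚ

infix 4 _≋_
_≋_ : Series → Series → Set
F ≋ G = ∀ n → F n ≡ G n

fromℕ : ℕ → ℚ
fromℕ n = (+ n) / 1

sumTo : ℕ → (ℕ → ℚ) → ℚ
sumTo zero    f = 0ℚ
sumTo (suc n) f = sumTo n f + f n

const : ℚ → Series
const a zero    = a
const a (suc _) = 0ℚ

Z : Series
Z 1 = 1ℚ
Z _ = 0ℚ

infixl 6 _⊕_ _⊖_
infixl 7 _⊗_ _·_

_⊕_ : Series → Series → Series
(F ⊕ G) n = F n + G n

_⊖_ : Series → Series → Series
(F ⊖ G) n = F n - G n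

_·_ : ℚ → Series → Series
(a · F) n = a * F n

_⊗_ : Series → Series → Series
(F ⊗ G) n = sumTo (suc n) (λ i → F i * G (n ∸ i))

pow : Series → ℕ → Series
pow F zero    = const 1ℚ
pow F (suc k) = F ⊗ pow F k

-- composition F(G(z)), meaningful when G has zero constant term:
-- [z^n] F(G) = Σ_{k=0}^{n} F_k [z^n] G^k
_∘ₛ_ : Series → Series → Series
(F ∘ₛ G) n = sumTo (suc n) (λ k → F k * pow G k n)

-- division by z (used for a series with zero constant term)
divZ : Series → Series
divZ F n = F (suc n)

nth : List ℚ → ℕ → ℚ
nth []       _       = 0ℚ
nth (x ∷ _)  zero    = x
nth (_ ∷ xs) (suc n) = nth xs n

build : (List ℚ → ℚ) → ℕ → List ℚ
build step zero    = []
build step (suc n) = let prev = build step n in prev ++ (step prev ∷ [])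

byRecursion : (List ℚ → ℚ) → Series
byRecursion step n = nth (build step (suc n)) n

-- Multiplicative inverse 1/F of a series F with F 0 = 1:
-- b_0 = 1, b_n = - Σ_{i=1}^{n} F_i b_{n-i}.
recip : Series → Series
recip F = byRecursion step
  where
  step : List ℚ → ℚ
  step prev with length prev
  ... | zero  = 1ℚ
  ... | suc m = - sumTo (suc m) (λ j → F (suc j) * nth prev (m ∸ j))

-- Square root √F of a series F with F 0 = 1, normalised by √F(0) = 1:
-- s_0 = 1, s_n = (F_n - Σ_{i=1}^{n-1} s_i s_{n-i}) / 2.
sqrtS : Series → Series
sqrtS F = byRecursion step
  where
  step : List ℚ → ℚ
  step prev with length prev
  ... | zero  = 1ℚ
  ... | suc m = ½ * (F (suc m) - sumTo m (λ j → nth prev (suc j) * nth prev (m ∸ j)))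

Cz : Series
Cz = ½ · (const 1ℚ ⊖ sqrtS (const 1ℚ ⊖ (fromℕ 4 · (Z ⊗ Z))))

M1 : Series
M1 = divZ (½ · (const 1ℚ ⊖ Z ⊖
       sqrtS (((const 1ℚ ⊖ Z) ⊗ (const 1ℚ ⊖ Z)) ⊖ (fromℕ 4 · (Z ⊗ Z)))))

LambdaGF : (ℕ → ℕ) → Series
LambdaGF cnt zero    = 0ℚ
LambdaGF cnt (suc n) = fromℕ (cnt (suc n))

IsLambdaTilde : Series → Set
IsLambdaTilde L =
  L ≋ Cz ⊕ Z ⊗ (L ⊗ L)
         ⊕ Z ⊗ (L ∘ₛ (Z ⊗ recip (const 1ℚ ⊖ (fromℕ 2 · Cz))))
         ⊖ Z ⊗ L

-- Let T k be the generating function of de Bruijn terms whose free variables lie among k binders,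
-- so that Λ = T 0. Splitting a term at its root gives T k = k z + z (T k)² + z T (k+1). With
-- M = z + z M + z M² and W = z/(1-2zM), the family M + (T k)∘W satisfies the same system as
-- T (k+1), and this system determines its solution coefficient by coefficient; so
-- T (k+1) = M + (T k)∘W, and k = 0 gives the second equation. Substituting V = z/(1-z) into the
-- equation for Λ̃, the quadratic equations for C and zM give (1-z) C∘V = zM and
-- (z/(1-2C))∘V = V∘W, so Λ̃∘V satisfies the same (again uniquely solvable) equation as Λ.

module Submission where

open import Defs
open import Data.Nat as ℕ using (ℕ; zero; suc; _∸_; _≤_; _<_; z≤n; s≤s)
import Data.Nat.Properties as ℕP
import Data.Integer as ℤ
import Data.Integer.Properties as ℤP
open import Data.Rational as ℚ using (ℚ; 0ℚ; 1ℚ; ½; _+_; _*_; -_; _-_)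
import Data.Rational.Properties as ℚP
import Data.Rational.Unnormalised as ℚᵘ
import Data.Rational.Unnormalised.Properties as ℚᵘP
import Data.Rational.Solver as ℚSolver
open import Data.List using (List; []; _∷_; _++_; length)
import Data.List.Properties as ListP
open import Data.Fin as Fin using (Fin; toℕ; fromℕ<)
import Data.Fin.Properties as FinP
open import Data.Product using (Σ; _×_; _,_; proj₁)
open import Data.Product.Function.NonDependent.Propositional using (_×-↔_)
open import Data.Product.Function.Dependent.Propositional using (Σ-↔)
open import Data.Sum using (_⊎_; inj₁; inj₂)
open import Data.Sum.Function.Propositional using (_⊎-↔_)
open import Data.Empty using (⊥-elim)
open import Function using (_∘_)
open import Function.Bundles using (_↔_; mk↔ₛ′; Injection)
open import Function.Properties.Inverse using (↔-refl; ↔-sym; ↔-trans; ↔⇒↣)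
open import Algebra.Bundles using (CommutativeRing)
open import Algebra.Structures using (IsCommutativeRing)
open import Algebra.Solver.Ring.AlmostCommutativeRing
  using (fromCommutativeRing; _-Raw-AlmostCommutative⟶_; Induced-equivalence)
import Algebra.Properties.CommutativeSemigroup as CommutativeSemigroupProperties
open import Relation.Binary.PropositionalEquality
open import Relation.Binary.Definitions using (WeaklyDecidable)
import Relation.Binary.Reasoning.Setoid
open import Relation.Nullary using (yes; no)
open import Relation.Nullary.Decidable.Core using (dec⇒maybe)
import Data.Maybe as Maybe
open import Data.Unit using (⊤; tt)

-- Finite sums

sumTo-cong-< : ∀ n {f g : ℕ → ℚ} → (∀ i → i < n → f i ≡ g i) → sumTo n f ≡ sumTo n g
sumTo-cong-< zero    eq = refl
sumTo-cong-< (suc n) eq = cong₂ _+_ (sumTo-cong-< n (λ i i<n → eq i (ℕP.m<n⇒m<1+n i<n))) (eq n ℕP.≤-refl)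

sumTo-cong : ∀ n {f g : ℕ → ℚ} → (∀ i → f i ≡ g i) → sumTo n f ≡ sumTo n g
sumTo-cong n eq = sumTo-cong-< n (λ i _ → eq i)

sumTo-+ : ∀ n (f g : ℕ → ℚ) → sumTo n (λ i → f i + g i) ≡ sumTo n f + sumTo n g
sumTo-+ zero    f g = sym (ℚP.+-identityˡ 0ℚ)
sumTo-+ (suc n) f g = trans (cong (_+ (f n + g n)) (sumTo-+ n f g)) (+-interchange (sumTo n f) (sumTo n g) (f n) (g n))
  where
  open CommutativeSemigroupProperties (CommutativeRing.+-commutativeSemigroup ℚP.+-*-commutativeRing)
    renaming (interchange to +-interchange)

*-distribˡ-sumTo : ∀ n a (f : ℕ → ℚ) → a * sumTo n f ≡ sumTo n (λ i → a * f i)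
*-distribˡ-sumTo zero    a f = ℚP.*-zeroʳ a
*-distribˡ-sumTo (suc n) a f =
  trans (ℚP.*-distribˡ-+ a (sumTo n f) (f n)) (cong (_+ a * f n) (*-distribˡ-sumTo n a f))

*-distribʳ-sumTo : ∀ n a (f : ℕ → ℚ) → sumTo n f * a ≡ sumTo n (λ i → f i * a)
*-distribʳ-sumTo n a f =
  trans (ℚP.*-comm _ a) (trans (*-distribˡ-sumTo n a f) (sumTo-cong n (λ i → ℚP.*-comm a (f i))))

neg-distrib-sumTo : ∀ n (f : ℕ → ℚ) → - sumTo n f ≡ sumTo n (λ i → - f i)
neg-distrib-sumTo zero    f = refl
neg-distrib-sumTo (suc n) f =
  trans (ℚP.neg-distrib-+ (sumTo n f) (f n)) (cong (_+ - f n) (neg-distrib-sumTo n f))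

sumTo-zero : ∀ n (f : ℕ → ℚ) → (∀ i → i < n → f i ≡ 0ℚ) → sumTo n f ≡ 0ℚ
sumTo-zero n f vanish = trans (sumTo-cong-< n vanish) (lemma n)
  where
  lemma : ∀ n → sumTo n (λ _ → 0ℚ) ≡ 0ℚ
  lemma zero    = refl
  lemma (suc n) = cong (_+ 0ℚ) (lemma n)

sumTo-unfoldˡ : ∀ n (f : ℕ → ℚ) → sumTo (suc n) f ≡ f 0 + sumTo n (λ i → f (suc i))
sumTo-unfoldˡ zero    f = trans (ℚP.+-identityˡ (f 0)) (sym (ℚP.+-identityʳ (f 0)))
sumTo-unfoldˡ (suc n) f =
  trans (cong (_+ f (suc n)) (sumTo-unfoldˡ n f)) (ℚP.+-assoc (f 0) _ _)

sumTo-*-sumTo : ∀ n m (f g : ℕ → ℚ) →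
  sumTo n f * sumTo m g ≡ sumTo n (λ i → sumTo m (λ j → f i * g j))
sumTo-*-sumTo n m f g = trans (*-distribʳ-sumTo n (sumTo m g) f)
                              (sumTo-cong n (λ i → *-distribˡ-sumTo m (f i) g))

sumTo-swap : ∀ n m (f : ℕ → ℕ → ℚ) →
  sumTo n (λ i → sumTo m (λ j → f i j)) ≡ sumTo m (λ j → sumTo n (λ i → f i j))
sumTo-swap zero    m f = sym (sumTo-zero m _ (λ _ _ → refl))
sumTo-swap (suc n) m f =
  trans (cong (_+ sumTo m (f n)) (sumTo-swap n m f)) (sym (sumTo-+ m _ (f n)))

sumTo-reverse : ∀ n (f : ℕ → ℚ) → sumTo (suc n) f ≡ sumTo (suc n) (λ i → f (n ∸ i))
sumTo-reverse zero    f = refl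
sumTo-reverse (suc n) f = begin
    sumTo (suc n) f + f (suc n)
  ≡⟨ cong (_+ f (suc n)) (sumTo-reverse n f) ⟩
    sumTo (suc n) (λ i → f (n ∸ i)) + f (suc n)
  ≡⟨ ℚP.+-comm _ (f (suc n)) ⟩
    f (suc n) + sumTo (suc n) (λ i → f (n ∸ i))
  ≡⟨ sym (sumTo-unfoldˡ (suc n) (λ i → f (suc n ∸ i))) ⟩
    sumTo (suc (suc n)) (λ i → f (suc n ∸ i)) ∎
  where open ≡-Reasoning

sumTo-extend : ∀ {m n} (f : ℕ → ℚ) → m ≤ n → (∀ i → m ≤ i → i < n → f i ≡ 0ℚ) →
  sumTo m f ≡ sumTo n f
sumTo-extend {n = zero}  f z≤n vanish = refl
sumTo-extend {m} {suc n} f m≤1+n vanish with ℕP.m≤n⇒m<n∨m≡n m≤1+n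
... | inj₂ refl      = refl
... | inj₁ (s≤s m≤n) = begin
    sumTo m f                ≡⟨ sumTo-extend f m≤n (λ i m≤i i<n → vanish i m≤i (ℕP.m<n⇒m<1+n i<n)) ⟩
    sumTo n f                ≡⟨ sym (ℚP.+-identityʳ _) ⟩
    sumTo n f + 0ℚ           ≡⟨ cong (sumTo n f +_) (sym (vanish n m≤n ℕP.≤-refl)) ⟩
    sumTo n f + f n          ∎
  where open ≡-Reasoning

sumTo-single : ∀ n p (f : ℕ → ℚ) → p < n → (∀ i → i < n → i ≢ p → f i ≡ 0ℚ) → sumTo n f ≡ f p
sumTo-single (suc n) p f p<1+n vanish with p ℕ.≟ n
... | yes refl = trans (cong (_+ f p) (sumTo-zero n f (λ i i<n → vanish i (ℕP.m<n⇒m<1+n i<n) (ℕP.<⇒≢ i<n))))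
                       (ℚP.+-identityˡ _)
... | no p≢n   = trans (cong (sumTo n f +_) (vanish n ℕP.≤-refl (p≢n ∘ sym)))
                       (trans (ℚP.+-identityʳ _)
                              (sumTo-single n p f (ℕP.≤∧≢⇒< (ℕP.≤-pred p<1+n) p≢n)
                                            (λ i i<n → vanish i (ℕP.m<n⇒m<1+n i<n))))

sumTo-triangle : ∀ n (f : ℕ → ℕ → ℚ) →
  sumTo (suc n) (λ k → sumTo (suc k) (λ i → f i (k ∸ i))) ≡
  sumTo (suc n) (λ i → sumTo (suc (n ∸ i)) (λ j → f i j))
sumTo-triangle zero    f = refl
sumTo-triangle (suc n) f = begin
    sumTo (suc n) (λ k → sumTo (suc k) (λ i → f i (k ∸ i))) + sumTo (2 ℕ.+ n) (λ i → f i (suc n ∸ i))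
  ≡⟨ cong (_+ sumTo (2 ℕ.+ n) (λ i → f i (suc n ∸ i))) (sumTo-triangle n f) ⟩
    rows n + (sumTo (suc n) (λ i → f i (suc n ∸ i)) + f (suc n) (n ∸ n))
  ≡⟨ sym (ℚP.+-assoc (rows n) _ _) ⟩
    rows n + sumTo (suc n) (λ i → f i (suc n ∸ i)) + f (suc n) (n ∸ n)
  ≡⟨ cong (_+ f (suc n) (n ∸ n)) (sym (sumTo-+ (suc n) _ _)) ⟩
    sumTo (suc n) (λ i → sumTo (suc (n ∸ i)) (f i) + f i (suc n ∸ i)) + f (suc n) (n ∸ n)
  ≡⟨ cong (_+ f (suc n) (n ∸ n)) (sumTo-cong-< (suc n) λ i i<1+n → longer-row i (ℕP.≤-pred i<1+n)) ⟩
    sumTo (suc n) (λ i → sumTo (suc (suc n ∸ i)) (f i)) + f (suc n) (n ∸ n)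
  ≡⟨ cong (sumTo (suc n) (λ i → sumTo (suc (suc n ∸ i)) (f i)) +_) (sym (last-row (f (suc n)))) ⟩
    sumTo (2 ℕ.+ n) (λ i → sumTo (suc (suc n ∸ i)) (f i)) ∎
  where
  open ≡-Reasoning
  rows : ℕ → ℚ
  rows n = sumTo (suc n) (λ i → sumTo (suc (n ∸ i)) (f i))
  longer-row : ∀ i → i ≤ n → sumTo (suc (n ∸ i)) (f i) + f i (suc n ∸ i) ≡ sumTo (suc (suc n ∸ i)) (f i)
  longer-row i i≤n rewrite ℕP.+-∸-assoc 1 i≤n = refl
  last-row : ∀ g → sumTo (suc (n ∸ n)) g ≡ g (n ∸ n)
  last-row g rewrite ℕP.n∸n≡0 n = ℚP.+-identityˡ _

-- The ring of formal power series

0ₛ 1ₛ : Series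
0ₛ = const 0ℚ
1ₛ = const 1ℚ

negₛ : Series → Series
negₛ F n = - F n

const-0ℚ : ∀ n → const 0ℚ n ≡ 0ℚ
const-0ℚ zero    = refl
const-0ℚ (suc n) = refl

≋-refl : ∀ {F} → F ≋ F
≋-refl n = refl

≋-sym : ∀ {F G} → F ≋ G → G ≋ F
≋-sym F≋G n = sym (F≋G n)

≋-trans : ∀ {F G H} → F ≋ G → G ≋ H → F ≋ H
≋-trans F≋G G≋H n = trans (F≋G n) (G≋H n)

⊕-cong : ∀ {F F′ G G′} → F ≋ F′ → G ≋ G′ → F ⊕ G ≋ F′ ⊕ G′
⊕-cong F≋F′ G≋G′ n = cong₂ _+_ (F≋F′ n) (G≋G′ n)

⊖-cong : ∀ {F F′ G G′} → F ≋ F′ → G ≋ G′ → F ⊖ G ≋ F′ ⊖ G′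
⊖-cong F≋F′ G≋G′ n = cong₂ _-_ (F≋F′ n) (G≋G′ n)

negₛ-cong : ∀ {F F′} → F ≋ F′ → negₛ F ≋ negₛ F′
negₛ-cong F≋F′ n = cong -_ (F≋F′ n)

⊗-cong : ∀ {F F′ G G′} → F ≋ F′ → G ≋ G′ → F ⊗ G ≋ F′ ⊗ G′
⊗-cong F≋F′ G≋G′ n = sumTo-cong (suc n) (λ i → cong₂ _*_ (F≋F′ i) (G≋G′ (n ∸ i)))

·-cong : ∀ a {F G} → F ≋ G → a · F ≋ a · G
·-cong a F≋G n = cong (a *_) (F≋G n)

const-⊗ : ∀ a F → const a ⊗ F ≋ a · F
const-⊗ a F n = begin
    sumTo (suc n) (λ i → const a i * F (n ∸ i))
  ≡⟨ sumTo-unfoldˡ n _ ⟩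
    a * F n + sumTo n (λ i → 0ℚ * F (n ∸ suc i))
  ≡⟨ cong (a * F n +_) (sumTo-zero n _ (λ i _ → ℚP.*-zeroˡ (F (n ∸ suc i)))) ⟩
    a * F n + 0ℚ
  ≡⟨ ℚP.+-identityʳ (a * F n) ⟩
    a * F n ∎
  where open ≡-Reasoning

⊗-comm : ∀ F G → F ⊗ G ≋ G ⊗ F
⊗-comm F G n = trans (sumTo-reverse n _) (sumTo-cong-< (suc n) λ i i<1+n →
  trans (ℚP.*-comm (F (n ∸ i)) (G (n ∸ (n ∸ i))))
        (cong (λ j → G j * F (n ∸ i)) (ℕP.m∸[m∸n]≡n (ℕP.≤-pred i<1+n))))

⊗-identityˡ : ∀ F → 1ₛ ⊗ F ≋ F
⊗-identityˡ F n = trans (const-⊗ 1ℚ F n) (ℚP.*-identityˡ (F n))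

⊗-identityʳ : ∀ F → F ⊗ 1ₛ ≋ F
⊗-identityʳ F = ≋-trans (⊗-comm F 1ₛ) (⊗-identityˡ F)

⊗-distribˡ-⊕ : ∀ F G H → F ⊗ (G ⊕ H) ≋ F ⊗ G ⊕ F ⊗ H
⊗-distribˡ-⊕ F G H n =
  trans (sumTo-cong (suc n) (λ i → ℚP.*-distribˡ-+ (F i) (G (n ∸ i)) (H (n ∸ i)))) (sumTo-+ (suc n) _ _)

⊗-distribʳ-⊕ : ∀ F G H → (G ⊕ H) ⊗ F ≋ G ⊗ F ⊕ H ⊗ F
⊗-distribʳ-⊕ F G H n =
  trans (sumTo-cong (suc n) (λ i → ℚP.*-distribʳ-+ (F (n ∸ i)) (G i) (H i))) (sumTo-+ (suc n) _ _)

⊗-assoc : ∀ F G H → (F ⊗ G) ⊗ H ≋ F ⊗ (G ⊗ H)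
⊗-assoc F G H n = begin
    sumTo (suc n) (λ k → sumTo (suc k) (λ i → F i * G (k ∸ i)) * H (n ∸ k))
  ≡⟨ sumTo-cong (suc n) (λ k → *-distribʳ-sumTo (suc k) _ _) ⟩
    sumTo (suc n) (λ k → sumTo (suc k) (λ i → F i * G (k ∸ i) * H (n ∸ k)))
  ≡⟨ sumTo-cong (suc n) (λ k → sumTo-cong-< (suc k) λ i i<1+k →
       cong (λ j → F i * G (k ∸ i) * H (n ∸ j)) (sym (ℕP.m+[n∸m]≡n (ℕP.≤-pred i<1+k)))) ⟩
    sumTo (suc n) (λ k → sumTo (suc k) (λ i → term i (k ∸ i)))
  ≡⟨ sumTo-triangle n term ⟩
    sumTo (suc n) (λ i → sumTo (suc (n ∸ i)) (λ j → term i j))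
  ≡⟨ sumTo-cong (suc n) (λ i → trans (sumTo-cong (suc (n ∸ i)) (λ j →
       trans (ℚP.*-assoc (F i) _ _) (cong (λ k → F i * (G j * H k)) (sym (ℕP.∸-+-assoc n i j)))))
       (sym (*-distribˡ-sumTo (suc (n ∸ i)) (F i) _))) ⟩
    sumTo (suc n) (λ i → F i * sumTo (suc (n ∸ i)) (λ j → G j * H (n ∸ i ∸ j))) ∎
  where
  open ≡-Reasoning
  term : ℕ → ℕ → ℚ
  term i j = F i * G j * H (n ∸ (i ℕ.+ j))

⊕-⊗-isCommutativeRing : IsCommutativeRing _≋_ _⊕_ _⊗_ negₛ 0ₛ 1ₛ
⊕-⊗-isCommutativeRing = record
  { isRing = record
    { +-isAbelianGroup = record
      { isGroup = record
        { isMonoid = record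
          { isSemigroup = record
            { isMagma = record
              { isEquivalence = record
                { refl  = λ {F} → ≋-refl {F}
                ; sym   = λ {F} {G} → ≋-sym {F} {G}
                ; trans = λ {F} {G} {H} → ≋-trans {F} {G} {H} }
              ; ∙-cong = λ {F} {F′} {G} {G′} → ⊕-cong {F} {F′} {G} {G′} }
            ; assoc = λ F G H n → ℚP.+-assoc (F n) (G n) (H n) }
          ; identity = (λ F n → trans (cong (_+ F n) (const-0ℚ n)) (ℚP.+-identityˡ (F n)))
                     , (λ F n → trans (cong (F n +_) (const-0ℚ n)) (ℚP.+-identityʳ (F n))) }
        ; inverse = (λ F n → trans (ℚP.+-inverseˡ (F n)) (sym (const-0ℚ n)))
                  , (λ F n → trans (ℚP.+-inverseʳ (F n)) (sym (const-0ℚ n)))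
        ; ⁻¹-cong = λ {F} {F′} → negₛ-cong {F} {F′} }
      ; comm = λ F G n → ℚP.+-comm (F n) (G n) }
    ; *-cong = λ {F} {F′} {G} {G′} → ⊗-cong {F} {F′} {G} {G′}
    ; *-assoc = ⊗-assoc
    ; *-identity = ⊗-identityˡ , ⊗-identityʳ
    ; distrib = ⊗-distribˡ-⊕ , ⊗-distribʳ-⊕ }
  ; *-comm = ⊗-comm }

⊕-⊗-commutativeRing : CommutativeRing _ _
⊕-⊗-commutativeRing = record { isCommutativeRing = ⊕-⊗-isCommutativeRing }

length-build : ∀ s n → length (build s n) ≡ n
length-build s zero    = refl
length-build s (suc n) =
  trans (ListP.length-++ (build s n)) (trans (ℕP.+-comm _ 1) (cong suc (length-build s n)))

nth-++ˡ : ∀ (xs ys : List ℚ) {i} → i < length xs → nth (xs ++ ys) i ≡ nth xs i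
nth-++ˡ (x ∷ xs) ys {zero}  _         = refl
nth-++ˡ (x ∷ xs) ys {suc i} (s≤s i<n) = nth-++ˡ xs ys i<n

nth-++-length : ∀ (xs : List ℚ) y → nth (xs ++ y ∷ []) (length xs) ≡ y
nth-++-length []       y = refl
nth-++-length (x ∷ xs) y = nth-++-length xs y

nth-build : ∀ s {n i} → i < n → nth (build s n) i ≡ byRecursion s i
nth-build s {suc n} {i} i<1+n with i ℕ.≟ n
... | yes refl = refl
... | no i≢n   = trans (nth-++ˡ (build s n) _ (subst (i <_) (sym (length-build s n)) i<n))
                       (nth-build s i<n)
  where i<n = ℕP.≤∧≢⇒< (ℕP.≤-pred i<1+n) i≢n

byRecursion-≡ : ∀ s n {v} →
  (∀ l → length l ≡ n → (∀ i → i < n → nth l i ≡ byRecursion s i) → s l ≡ v) →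
  byRecursion s n ≡ v
byRecursion-≡ s n s≡v = begin
    nth (build s n ++ s (build s n) ∷ []) n
  ≡⟨ cong (nth (build s n ++ s (build s n) ∷ [])) (sym (length-build s n)) ⟩
    nth (build s n ++ s (build s n) ∷ []) (length (build s n))
  ≡⟨ nth-++-length (build s n) _ ⟩
    s (build s n)
  ≡⟨ s≡v (build s n) (length-build s n) (λ i → nth-build s) ⟩
    _ ∎
  where open ≡-Reasoning

recip-suc : ∀ F m → recip F (suc m) ≡ - sumTo (suc m) (λ j → F (suc j) * recip F (m ∸ j))
recip-suc F m = byRecursion-≡ _ (suc m) λ where
  (x ∷ xs) refl previous → cong -_ (sumTo-cong (suc m) (λ j →
    cong (F (suc j) *_) (previous (m ∸ j) (s≤s (ℕP.m∸n≤m m j)))))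

sqrtS-suc : ∀ F m → sqrtS F (suc m) ≡ ½ * (F (suc m) - sumTo m (λ j → sqrtS F (suc j) * sqrtS F (m ∸ j)))
sqrtS-suc F m = byRecursion-≡ _ (suc m) λ where
  (x ∷ xs) refl previous → cong (λ S → ½ * (F (suc m) - S)) (sumTo-cong-< m (λ j j<m →
    cong₂ _*_ (previous (suc j) (s≤s j<m)) (previous (m ∸ j) (s≤s (ℕP.m∸n≤m m j)))))

⊗-recip : ∀ F → F 0 ≡ 1ℚ → F ⊗ recip F ≋ 1ₛ
⊗-recip F F₀≡1 zero    rewrite F₀≡1 = refl
⊗-recip F F₀≡1 (suc m) = begin
    sumTo (2 ℕ.+ m) (λ i → F i * recip F (suc m ∸ i))
  ≡⟨ sumTo-unfoldˡ (suc m) _ ⟩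
    F 0 * recip F (suc m) + S
  ≡⟨ cong₂ (λ a b → a * b + S) F₀≡1 (recip-suc F m) ⟩
    1ℚ * (- S) + S
  ≡⟨ cong (_+ S) (ℚP.*-identityˡ (- S)) ⟩
    - S + S
  ≡⟨ ℚP.+-inverseˡ S ⟩
    0ℚ ∎
  where
  open ≡-Reasoning
  S = sumTo (suc m) (λ j → F (suc j) * recip F (m ∸ j))

sqrtS-square : ∀ F → F 0 ≡ 1ℚ → sqrtS F ⊗ sqrtS F ≋ F
sqrtS-square F F₀≡1 zero    = sym F₀≡1
sqrtS-square F F₀≡1 (suc m) = begin
    sumTo (2 ℕ.+ m) (λ i → s i * s (suc m ∸ i))
  ≡⟨ sumTo-unfoldˡ (suc m) _ ⟩
    1ℚ * s (suc m) + (S + s (suc m) * s (m ∸ m))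
  ≡⟨ cong (λ k → 1ℚ * s (suc m) + (S + s (suc m) * s k)) (ℕP.n∸n≡0 m) ⟩
    1ℚ * s (suc m) + (S + s (suc m) * 1ℚ)
  ≡⟨ cong (λ x → 1ℚ * x + (S + x * 1ℚ)) (sqrtS-suc F m) ⟩
    1ℚ * (½ * (F (suc m) - S)) + (S + ½ * (F (suc m) - S) * 1ℚ)
  ≡⟨ halves (F (suc m)) S ⟩
    F (suc m) ∎
  where
  open ≡-Reasoning
  open ℚSolver.+-*-Solver
  s = sqrtS F
  S = sumTo m (λ j → s (suc j) * s (m ∸ j))
  halves : ∀ a b → 1ℚ * (½ * (a - b)) + (b + ½ * (a - b) * 1ℚ) ≡ a
  halves = solve 2 (λ a b → con 1ℚ :* (con ½ :* (a :- b)) :+ (b :+ con ½ :* (a :- b) :* con 1ℚ) := a) refl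

const-homomorphism : ℚ.+-*-rawRing -Raw-AlmostCommutative⟶ fromCommutativeRing ⊕-⊗-commutativeRing
const-homomorphism = record
  { ⟦_⟧    = const
  ; +-homo = λ a b → λ { zero → refl ; (suc n) → sym (ℚP.+-identityʳ 0ℚ) }
  ; *-homo = λ a b → ≋-trans (const-* a b) (≋-sym (const-⊗ a (const b)))
  ; -‿homo = λ a → λ { zero → refl ; (suc n) → refl }
  ; 0-homo = ≋-refl
  ; 1-homo = ≋-refl }
  where
  const-* : ∀ a b → const (a * b) ≋ a · const b
  const-* a b zero    = refl
  const-* a b (suc n) = sym (ℚP.*-zeroʳ a)

const-≟ : WeaklyDecidable (Induced-equivalence const-homomorphism)
const-≟ a b = Maybe.map (λ a≡b n → cong (λ c → const c n) a≡b) (dec⇒maybe (a ℚP.≟ b))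

open import Algebra.Solver.Ring ℚ.+-*-rawRing (fromCommutativeRing ⊕-⊗-commutativeRing) const-homomorphism const-≟
  using (solve; _:+_; _:*_; _:-_; _:=_; con)

module ≋-Reasoning = Relation.Binary.Reasoning.Setoid (CommutativeRing.setoid ⊕-⊗-commutativeRing)

Z⊗-zero : ∀ F → (Z ⊗ F) 0 ≡ 0ℚ
Z⊗-zero F = trans (ℚP.+-identityˡ (0ℚ * F 0)) (ℚP.*-zeroˡ (F 0))

Z⊗-suc : ∀ F m → (Z ⊗ F) (suc m) ≡ F m
Z⊗-suc F m = trans (sumTo-single (2 ℕ.+ m) 1 _ (s≤s (s≤s z≤n)) off-diagonal) (ℚP.*-identityˡ (F m))
  where
  off-diagonal : ∀ i → i < 2 ℕ.+ m → i ≢ 1 → Z i * F (suc m ∸ i) ≡ 0ℚ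
  off-diagonal zero          _ _   = ℚP.*-zeroˡ (F (suc m))
  off-diagonal (suc zero)    _ i≢1 = ⊥-elim (i≢1 refl)
  off-diagonal (suc (suc i)) _ _   = ℚP.*-zeroˡ (F (suc m ∸ suc (suc i)))

Z⊗-divZ : ∀ F → F 0 ≡ 0ℚ → F ≋ Z ⊗ divZ F
Z⊗-divZ F F₀≡0 zero    = trans F₀≡0 (sym (Z⊗-zero (divZ F)))
Z⊗-divZ F F₀≡0 (suc n) = sym (Z⊗-suc (divZ F) n)

Z⊗-cancel : ∀ F G → Z ⊗ F ≋ Z ⊗ G → F ≋ G
Z⊗-cancel F G zF≋zG n = trans (sym (Z⊗-suc F n)) (trans (zF≋zG (suc n)) (Z⊗-suc G n))

≋0-⊖ : ∀ {F G} → F ≋ G → F ⊖ G ≋ 0ₛ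
≋0-⊖ {F} {G} F≋G n = trans (cong (_- G n) (F≋G n)) (trans (ℚP.+-inverseʳ (G n)) (sym (const-0ℚ n)))

≋0-⊕ : ∀ {D E} → D ≋ 0ₛ → E ≋ 0ₛ → D ⊕ E ≋ 0ₛ
≋0-⊕ D≋0 E≋0 = ≋-trans (⊕-cong D≋0 E≋0) (CommutativeRing.+-identityˡ ⊕-⊗-commutativeRing 0ₛ)

≋0-⊗ˡ : ∀ C {D} → D ≋ 0ₛ → C ⊗ D ≋ 0ₛ
≋0-⊗ˡ C D≋0 = ≋-trans (⊗-cong (≋-refl {C}) D≋0) (CommutativeRing.zeroʳ ⊕-⊗-commutativeRing C)

≋0-⊗ʳ : ∀ C {D} → D ≋ 0ₛ → D ⊗ C ≋ 0ₛ
≋0-⊗ʳ C {D} D≋0 = ≋-trans (⊗-comm D C) (≋0-⊗ˡ C D≋0)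

-- To derive F ≋ G from hypotheses Lᵢ ≋ Rᵢ, the ring solver checks F = G + Σ cᵢ (Lᵢ - Rᵢ)
-- as a polynomial identity, and the combination is then discarded.
≋-modulo : ∀ {F G D} → F ≋ G ⊕ D → D ≋ 0ₛ → F ≋ G
≋-modulo {G = G} F≋G+D D≋0 =
  ≋-trans F≋G+D (≋-trans (⊕-cong (≋-refl {G}) D≋0) (CommutativeRing.+-identityʳ ⊕-⊗-commutativeRing G))

infix 4 _≈[_]_
_≈[_]_ : Series → ℕ → Series → Set
F ≈[ n ] G = ∀ m → m < n → F m ≡ G m

≋⇒≈[] : ∀ {F G} n → F ≋ G → F ≈[ n ] G
≋⇒≈[] n F≋G m _ = F≋G m

⊕-≈[] : ∀ {F F′ G G′ n} → F ≈[ n ] F′ → G ≈[ n ] G′ → F ⊕ G ≈[ n ] F′ ⊕ G′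
⊕-≈[] F≈F′ G≈G′ m m<n = cong₂ _+_ (F≈F′ m m<n) (G≈G′ m m<n)

⊗-≈[] : ∀ {F F′ G G′ n} → F ≈[ n ] F′ → G ≈[ n ] G′ → F ⊗ G ≈[ n ] F′ ⊗ G′
⊗-≈[] F≈F′ G≈G′ m m<n = sumTo-cong-< (suc m) λ i i<1+m →
  cong₂ _*_ (F≈F′ i (ℕP.≤-<-trans (ℕP.≤-pred i<1+m) m<n)) (G≈G′ (m ∸ i) (ℕP.≤-<-trans (ℕP.m∸n≤m m i) m<n))

Z⊗-≈[] : ∀ {F G n} → F ≈[ n ] G → Z ⊗ F ≈[ suc n ] Z ⊗ G
Z⊗-≈[] {F} {G} F≈G zero    _         = trans (Z⊗-zero F) (sym (Z⊗-zero G))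
Z⊗-≈[] {F} {G} F≈G (suc m) (s≤s m<n) = trans (Z⊗-suc F m) (trans (F≈G m m<n) (sym (Z⊗-suc G m)))

Contractive : {I : Set} → ((I → Series) → (I → Series)) → Set
Contractive Φ = ∀ n X Y → (∀ i → X i ≈[ n ] Y i) → ∀ i → Φ X i ≈[ suc n ] Φ Y i

fixpoint-unique : ∀ {I : Set} {Φ : (I → Series) → (I → Series)} → Contractive Φ →
  ∀ {X Y} → (∀ i → X i ≋ Φ X i) → (∀ i → Y i ≋ Φ Y i) → ∀ i → X i ≋ Y i
fixpoint-unique contractive {X} {Y} X≋ΦX Y≋ΦY i n = agree (suc n) i n ℕP.≤-refl
  where
  agree : ∀ n i → X i ≈[ n ] Y i
  agree (suc n) i m m<1+n =
    trans (X≋ΦX i m) (trans (contractive n X Y (agree n) i m m<1+n) (sym (Y≋ΦY i m)))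

Contractive₁ : (Series → Series) → Set
Contractive₁ Φ = ∀ n X Y → X ≈[ n ] Y → Φ X ≈[ suc n ] Φ Y

fixpoint-unique₁ : ∀ {Φ} → Contractive₁ Φ → ∀ {X Y} → X ≋ Φ X → Y ≋ Φ Y → X ≋ Y
fixpoint-unique₁ {Φ} contractive {X} {Y} X≋ΦX Y≋ΦY =
  fixpoint-unique {⊤} {λ F i → Φ (F i)} (λ n F G F≈G i → contractive n (F i) (G i) (F≈G i))
                  {λ _ → X} {λ _ → Y} (λ _ → X≋ΦX) (λ _ → Y≋ΦY) tt

-- Composition and reciprocals

pow-vanish : ∀ G → G 0 ≡ 0ℚ → ∀ k n → n < k → pow G k n ≡ 0ℚ
pow-vanish G G₀≡0 (suc k) n (s≤s n≤k) = sumTo-zero (suc n) _ vanish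
  where
  vanish : ∀ i → i < suc n → G i * pow G k (n ∸ i) ≡ 0ℚ
  vanish zero    _ = trans (cong (_* pow G k n) G₀≡0) (ℚP.*-zeroˡ (pow G k n))
  vanish (suc i) (s≤s i<n) =
    trans (cong (G (suc i) *_) (pow-vanish G G₀≡0 k (n ∸ suc i) n∸[1+i]<k)) (ℚP.*-zeroʳ (G (suc i)))
    where
    n∸[1+i]<k : n ∸ suc i < k
    n∸[1+i]<k = ℕP.<-≤-trans (ℕP.∸-monoʳ-< {o = 0} (s≤s z≤n) i<n) n≤k

pow-cong : ∀ {G G′} → G ≋ G′ → ∀ k → pow G k ≋ pow G′ k
pow-cong G≋G′ zero    = ≋-refl
pow-cong G≋G′ (suc k) = ⊗-cong G≋G′ (pow-cong G≋G′ k)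

pow-+ : ∀ G i j → pow G (i ℕ.+ j) ≋ pow G i ⊗ pow G j
pow-+ G zero    j = ≋-sym (⊗-identityˡ (pow G j))
pow-+ G (suc i) j = ≋-trans (⊗-cong (≋-refl {G}) (pow-+ G i j)) (≋-sym (⊗-assoc G (pow G i) (pow G j)))

∘ₛ-cong : ∀ {F F′ G G′} → F ≋ F′ → G ≋ G′ → F ∘ₛ G ≋ F′ ∘ₛ G′
∘ₛ-cong F≋F′ G≋G′ n = sumTo-cong (suc n) (λ k → cong₂ _*_ (F≋F′ k) (pow-cong G≋G′ k n))

∘ₛ-≈[] : ∀ {F F′ n} G → F ≈[ n ] F′ → F ∘ₛ G ≈[ n ] F′ ∘ₛ G
∘ₛ-≈[] G F≈F′ m m<n = sumTo-cong-< (suc m) (λ k k<1+m →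
  cong (_* pow G k m) (F≈F′ k (ℕP.≤-<-trans (ℕP.≤-pred k<1+m) m<n)))

∘ₛ-zero : ∀ F G → (F ∘ₛ G) 0 ≡ F 0
∘ₛ-zero F G = trans (ℚP.+-identityˡ (F 0 * 1ℚ)) (ℚP.*-identityʳ (F 0))

∘ₛ-extend : ∀ F G → G 0 ≡ 0ℚ → ∀ {m n} → m ≤ n → (F ∘ₛ G) m ≡ sumTo (suc n) (λ k → F k * pow G k m)
∘ₛ-extend F G G₀≡0 m≤n = sumTo-extend _ (s≤s m≤n) (λ k m<k _ →
  trans (cong (F k *_) (pow-vanish G G₀≡0 k _ m<k)) (ℚP.*-zeroʳ (F k)))

⊕-∘ₛ : ∀ F H G → (F ⊕ H) ∘ₛ G ≋ F ∘ₛ G ⊕ H ∘ₛ G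
⊕-∘ₛ F H G n = trans (sumTo-cong (suc n) (λ k → ℚP.*-distribʳ-+ (pow G k n) (F k) (H k))) (sumTo-+ (suc n) _ _)

⊖-∘ₛ : ∀ F H G → (F ⊖ H) ∘ₛ G ≋ F ∘ₛ G ⊖ H ∘ₛ G
⊖-∘ₛ F H G n = begin
    sumTo (suc n) (λ k → (F k - H k) * pow G k n)
  ≡⟨ sumTo-cong (suc n) (λ k → trans (ℚP.*-distribʳ-+ (pow G k n) (F k) (- H k))
                                     (cong (F k * pow G k n +_) (sym (ℚP.neg-distribˡ-* (H k) (pow G k n))))) ⟩
    sumTo (suc n) (λ k → F k * pow G k n + - (H k * pow G k n))
  ≡⟨ sumTo-+ (suc n) _ _ ⟩
    (F ∘ₛ G) n + sumTo (suc n) (λ k → - (H k * pow G k n))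
  ≡⟨ cong ((F ∘ₛ G) n +_) (sym (neg-distrib-sumTo (suc n) _)) ⟩
    (F ∘ₛ G) n - (H ∘ₛ G) n ∎
  where open ≡-Reasoning

·-∘ₛ : ∀ a F G → (a · F) ∘ₛ G ≋ a · (F ∘ₛ G)
·-∘ₛ a F G n = trans (sumTo-cong (suc n) (λ k → ℚP.*-assoc a (F k) (pow G k n)))
                     (sym (*-distribˡ-sumTo (suc n) a _))

const-∘ₛ : ∀ a G → const a ∘ₛ G ≋ const a
const-∘ₛ a G n = begin
    sumTo (suc n) (λ k → const a k * pow G k n)
  ≡⟨ sumTo-unfoldˡ n _ ⟩
    a * 1ₛ n + sumTo n (λ k → 0ℚ * pow G (suc k) n)
  ≡⟨ cong₂ _+_ (a*1ₛ n) (sumTo-zero n _ (λ k _ → ℚP.*-zeroˡ (pow G (suc k) n))) ⟩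
    const a n + 0ℚ
  ≡⟨ ℚP.+-identityʳ (const a n) ⟩
    const a n ∎
  where
  open ≡-Reasoning
  a*1ₛ : ∀ n → a * 1ₛ n ≡ const a n
  a*1ₛ zero    = ℚP.*-identityʳ a
  a*1ₛ (suc n) = ℚP.*-zeroʳ a

Z-∘ₛ : ∀ G → G 0 ≡ 0ℚ → Z ∘ₛ G ≋ G
Z-∘ₛ G G₀≡0 zero    = trans (∘ₛ-zero Z G) (sym G₀≡0)
Z-∘ₛ G G₀≡0 (suc m) =
  trans (sumTo-single (2 ℕ.+ m) 1 _ (s≤s (s≤s z≤n)) off-diagonal)
        (trans (ℚP.*-identityˡ (pow G 1 (suc m))) (⊗-identityʳ G (suc m)))
  where
  off-diagonal : ∀ i → i < 2 ℕ.+ m → i ≢ 1 → Z i * pow G i (suc m) ≡ 0ℚ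
  off-diagonal zero          _ _   = ℚP.*-zeroˡ (pow G 0 (suc m))
  off-diagonal (suc zero)    _ i≢1 = ⊥-elim (i≢1 refl)
  off-diagonal (suc (suc i)) _ _   = ℚP.*-zeroˡ (pow G (2 ℕ.+ i) (suc m))

⊗-∘ₛ-double-sum : ∀ F H G → G 0 ≡ 0ℚ → ∀ n →
  ((F ⊗ H) ∘ₛ G) n ≡ sumTo (suc n) (λ i → sumTo (suc n) (λ j → F i * H j * pow G (i ℕ.+ j) n))
⊗-∘ₛ-double-sum F H G G₀≡0 n = begin
    sumTo (suc n) (λ k → sumTo (suc k) (λ i → F i * H (k ∸ i)) * pow G k n)
  ≡⟨ sumTo-cong (suc n) (λ k → *-distribʳ-sumTo (suc k) _ _) ⟩
    sumTo (suc n) (λ k → sumTo (suc k) (λ i → F i * H (k ∸ i) * pow G k n))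
  ≡⟨ sumTo-cong (suc n) (λ k → sumTo-cong-< (suc k) λ i i<1+k →
       cong (λ l → F i * H (k ∸ i) * pow G l n) (sym (ℕP.m+[n∸m]≡n (ℕP.≤-pred i<1+k)))) ⟩
    sumTo (suc n) (λ k → sumTo (suc k) (λ i → term i (k ∸ i)))
  ≡⟨ sumTo-triangle n term ⟩
    sumTo (suc n) (λ i → sumTo (suc (n ∸ i)) (term i))
  ≡⟨ sumTo-cong-< (suc n) (λ i i<1+n → sumTo-extend (term i) (s≤s (ℕP.m∸n≤m n i))
       (λ j n∸i<j _ → high-degree i j (ℕP.≤-pred i<1+n) n∸i<j)) ⟩
    sumTo (suc n) (λ i → sumTo (suc n) (term i)) ∎
  where
  open ≡-Reasoning
  term : ℕ → ℕ → ℚ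
  term i j = F i * H j * pow G (i ℕ.+ j) n
  high-degree : ∀ i j → i ≤ n → n ∸ i < j → term i j ≡ 0ℚ
  high-degree i j i≤n n∸i<j =
    trans (cong (F i * H j *_) (pow-vanish G G₀≡0 (i ℕ.+ j) n
            (subst (_< i ℕ.+ j) (ℕP.m+[n∸m]≡n i≤n) (ℕP.+-monoʳ-< i n∸i<j))))
          (ℚP.*-zeroʳ (F i * H j))

∘ₛ-⊗-double-sum : ∀ F H G → G 0 ≡ 0ℚ → ∀ n →
  ((F ∘ₛ G) ⊗ (H ∘ₛ G)) n ≡ sumTo (suc n) (λ i → sumTo (suc n) (λ j → F i * H j * (pow G i ⊗ pow G j) n))
∘ₛ-⊗-double-sum F H G G₀≡0 n = begin
    sumTo (suc n) (λ m → (F ∘ₛ G) m * (H ∘ₛ G) (n ∸ m))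
  ≡⟨ sumTo-cong-< (suc n) (λ m m<1+n → cong₂ _*_ (∘ₛ-extend F G G₀≡0 (ℕP.≤-pred m<1+n))
                                                 (∘ₛ-extend H G G₀≡0 (ℕP.m∸n≤m n m))) ⟩
    sumTo (suc n) (λ m → sumTo (suc n) (λ i → F i * P i m) * sumTo (suc n) (λ j → H j * P j (n ∸ m)))
  ≡⟨ sumTo-cong (suc n) (λ m → sumTo-*-sumTo (suc n) (suc n) _ _) ⟩
    sumTo (suc n) (λ m → sumTo (suc n) (λ i → sumTo (suc n) (λ j → F i * P i m * (H j * P j (n ∸ m)))))
  ≡⟨ sumTo-swap (suc n) (suc n) _ ⟩
    sumTo (suc n) (λ i → sumTo (suc n) (λ m → sumTo (suc n) (λ j → F i * P i m * (H j * P j (n ∸ m)))))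
  ≡⟨ sumTo-cong (suc n) (λ i → sumTo-swap (suc n) (suc n) _) ⟩
    sumTo (suc n) (λ i → sumTo (suc n) (λ j → sumTo (suc n) (λ m → F i * P i m * (H j * P j (n ∸ m)))))
  ≡⟨ sumTo-cong (suc n) (λ i → sumTo-cong (suc n) (λ j →
       trans (sumTo-cong (suc n) (λ m → *-interchange (F i) (P i m) (H j) (P j (n ∸ m))))
             (sym (*-distribˡ-sumTo (suc n) (F i * H j) _)))) ⟩
    sumTo (suc n) (λ i → sumTo (suc n) (λ j → F i * H j * (pow G i ⊗ pow G j) n)) ∎
  where
  open ≡-Reasoning
  open CommutativeSemigroupProperties (CommutativeRing.*-commutativeSemigroup ℚP.+-*-commutativeRing)
    renaming (interchange to *-interchange)
  P : ℕ → ℕ → ℚ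
  P = pow G

⊗-∘ₛ : ∀ F H G → G 0 ≡ 0ℚ → (F ⊗ H) ∘ₛ G ≋ (F ∘ₛ G) ⊗ (H ∘ₛ G)
⊗-∘ₛ F H G G₀≡0 n =
  trans (⊗-∘ₛ-double-sum F H G G₀≡0 n)
        (trans (sumTo-cong (suc n) (λ i → sumTo-cong (suc n) (λ j → cong (F i * H j *_) (pow-+ G i j n))))
               (sym (∘ₛ-⊗-double-sum F H G G₀≡0 n)))

Z⊗-∘ₛ : ∀ F G → G 0 ≡ 0ℚ → (Z ⊗ F) ∘ₛ G ≋ G ⊗ (F ∘ₛ G)
Z⊗-∘ₛ F G G₀≡0 = ≋-trans (⊗-∘ₛ Z F G G₀≡0) (⊗-cong (Z-∘ₛ G G₀≡0) (≋-refl {F ∘ₛ G}))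

pow-∘ₛ : ∀ H G → G 0 ≡ 0ℚ → ∀ j → pow (H ∘ₛ G) j ≋ pow H j ∘ₛ G
pow-∘ₛ H G G₀≡0 zero    = ≋-sym (const-∘ₛ 1ℚ G)
pow-∘ₛ H G G₀≡0 (suc j) =
  ≋-trans (⊗-cong (≋-refl {H ∘ₛ G}) (pow-∘ₛ H G G₀≡0 j)) (≋-sym (⊗-∘ₛ H (pow H j) G G₀≡0))

∘ₛ-assoc : ∀ F H G → H 0 ≡ 0ℚ → G 0 ≡ 0ℚ → (F ∘ₛ H) ∘ₛ G ≋ F ∘ₛ (H ∘ₛ G)
∘ₛ-assoc F H G H₀≡0 G₀≡0 n = begin
    sumTo (suc n) (λ k → (F ∘ₛ H) k * pow G k n)
  ≡⟨ sumTo-cong-< (suc n) (λ k k<1+n → cong (_* pow G k n) (∘ₛ-extend F H H₀≡0 (ℕP.≤-pred k<1+n))) ⟩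
    sumTo (suc n) (λ k → sumTo (suc n) (λ j → F j * pow H j k) * pow G k n)
  ≡⟨ sumTo-cong (suc n) (λ k → *-distribʳ-sumTo (suc n) _ _) ⟩
    sumTo (suc n) (λ k → sumTo (suc n) (λ j → F j * pow H j k * pow G k n))
  ≡⟨ sumTo-swap (suc n) (suc n) _ ⟩
    sumTo (suc n) (λ j → sumTo (suc n) (λ k → F j * pow H j k * pow G k n))
  ≡⟨ sumTo-cong (suc n) (λ j → trans (sumTo-cong (suc n) (λ k → ℚP.*-assoc (F j) _ _))
                                     (sym (*-distribˡ-sumTo (suc n) (F j) _))) ⟩
    sumTo (suc n) (λ j → F j * (pow H j ∘ₛ G) n)
  ≡⟨ sumTo-cong (suc n) (λ j → cong (F j *_) (sym (pow-∘ₛ H G G₀≡0 j n))) ⟩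
    sumTo (suc n) (λ j → F j * pow (H ∘ₛ G) j n) ∎
  where open ≡-Reasoning

⊗-cancelʳ-unit : ∀ {F G} Q → Q 0 ≡ 1ℚ → F ⊗ Q ≋ G ⊗ Q → F ≋ G
⊗-cancelʳ-unit {F} {G} Q Q₀≡1 FQ≋GQ = begin
  F                 ≈⟨ ≋-sym (⊗-identityʳ F) ⟩
  F ⊗ 1ₛ            ≈⟨ ⊗-cong (≋-refl {F}) (≋-sym (⊗-recip Q Q₀≡1)) ⟩
  F ⊗ (Q ⊗ recip Q) ≈⟨ ≋-sym (⊗-assoc F Q (recip Q)) ⟩
  (F ⊗ Q) ⊗ recip Q ≈⟨ ⊗-cong FQ≋GQ (≋-refl {recip Q}) ⟩
  (G ⊗ Q) ⊗ recip Q ≈⟨ ⊗-assoc G Q (recip Q) ⟩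
  G ⊗ (Q ⊗ recip Q) ≈⟨ ⊗-cong (≋-refl {G}) (⊗-recip Q Q₀≡1) ⟩
  G ⊗ 1ₛ            ≈⟨ ⊗-identityʳ G ⟩
  G                 ∎
  where open ≋-Reasoning

recip-∘ₛ : ∀ R G → R 0 ≡ 1ℚ → G 0 ≡ 0ℚ → (recip R ∘ₛ G) ⊗ (R ∘ₛ G) ≋ 1ₛ
recip-∘ₛ R G R₀≡1 G₀≡0 = begin
  (recip R ∘ₛ G) ⊗ (R ∘ₛ G) ≈⟨ ≋-sym (⊗-∘ₛ (recip R) R G G₀≡0) ⟩
  (recip R ⊗ R) ∘ₛ G        ≈⟨ ∘ₛ-cong (≋-trans (⊗-comm (recip R) R) (⊗-recip R R₀≡1)) (≋-refl {G}) ⟩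
  1ₛ ∘ₛ G                   ≈⟨ const-∘ₛ 1ℚ G ⟩
  1ₛ                        ∎
  where open ≋-Reasoning

infix 8 z/_
z/_ : Series → Series
z/ Q = Z ⊗ recip Q

z/-zero : ∀ Q → (z/ Q) 0 ≡ 0ℚ
z/-zero Q = Z⊗-zero (recip Q)

z/-⊗ : ∀ Q → Q 0 ≡ 1ℚ → (z/ Q) ⊗ Q ≋ Z
z/-⊗ Q Q₀≡1 = begin
  (Z ⊗ recip Q) ⊗ Q ≈⟨ solve 3 (λ z r q → (z :* r) :* q := z :* (q :* r)) ≋-refl Z (recip Q) Q ⟩
  Z ⊗ (Q ⊗ recip Q) ≈⟨ ⊗-cong (≋-refl {Z}) (⊗-recip Q Q₀≡1) ⟩
  Z ⊗ 1ₛ            ≈⟨ ⊗-identityʳ Z ⟩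
  Z                 ∎
  where open ≋-Reasoning

-- The series C(z) and z M(z,1)

half-difference-root : ∀ A B s → s ⊗ s ≋ A ⊗ A ⊖ fromℕ 4 · B →
  A ⊗ (½ · (A ⊖ s)) ≋ B ⊕ (½ · (A ⊖ s)) ⊗ (½ · (A ⊖ s))
half-difference-root A B s s²≋A²-4B = begin
  A ⊗ (½ · (A ⊖ s))                   ≈⟨ ⊗-cong (≋-refl {A}) half≋ ⟩
  A ⊗ (const ½ ⊗ (A ⊖ s))
    ≈⟨ ≋-modulo (solve 3 (λ A B s → A :* (con ½ :* (A :- s)) :=
                   B :+ (con ½ :* (A :- s)) :* (con ½ :* (A :- s))
                   :+ con (½ * ½) :* ((A :* A :- con (fromℕ 4) :* B) :- s :* s)) ≋-refl A B s)
                (≋0-⊗ˡ (const (½ * ½)) (≋0-⊖ (≋-trans (⊖-cong (≋-refl {A ⊗ A}) (const-⊗ (fromℕ 4) B))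
                                                       (≋-sym s²≋A²-4B)))) ⟩
  B ⊕ (const ½ ⊗ (A ⊖ s)) ⊗ (const ½ ⊗ (A ⊖ s))
                                      ≈⟨ ⊕-cong (≋-refl {B}) (⊗-cong (≋-sym half≋) (≋-sym half≋)) ⟩
  B ⊕ (½ · (A ⊖ s)) ⊗ (½ · (A ⊖ s))   ∎
  where
  open ≋-Reasoning
  half≋ : ½ · (A ⊖ s) ≋ const ½ ⊗ (A ⊖ s)
  half≋ = ≋-sym (const-⊗ ½ (A ⊖ s))

Cz-equation : Cz ≋ Z ⊗ Z ⊕ Cz ⊗ Cz
Cz-equation = ≋-trans (≋-sym (⊗-identityˡ Cz))
  (half-difference-root 1ₛ (Z ⊗ Z) (sqrtS D)
    (≋-trans (sqrtS-square D refl) (⊖-cong (≋-sym (⊗-identityˡ 1ₛ)) (≋-refl {fromℕ 4 · (Z ⊗ Z)}))))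
  where
  D : Series
  D = const 1ℚ ⊖ fromℕ 4 · (Z ⊗ Z)

zM-equation : (1ₛ ⊖ Z) ⊗ (Z ⊗ M1) ≋ Z ⊗ Z ⊕ (Z ⊗ M1) ⊗ (Z ⊗ M1)
zM-equation = begin
  (1ₛ ⊖ Z) ⊗ (Z ⊗ M1) ≈⟨ ⊗-cong (≋-refl {1ₛ ⊖ Z}) zM≋N ⟩
  (1ₛ ⊖ Z) ⊗ N        ≈⟨ half-difference-root (1ₛ ⊖ Z) (Z ⊗ Z) (sqrtS D) (sqrtS-square D refl) ⟩
  Z ⊗ Z ⊕ N ⊗ N       ≈⟨ ⊕-cong (≋-refl {Z ⊗ Z}) (⊗-cong (≋-sym zM≋N) (≋-sym zM≋N)) ⟩
  Z ⊗ Z ⊕ (Z ⊗ M1) ⊗ (Z ⊗ M1) ∎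
  where
  open ≋-Reasoning
  D N : Series
  D = (const 1ℚ ⊖ Z) ⊗ (const 1ℚ ⊖ Z) ⊖ fromℕ 4 · (Z ⊗ Z)
  N = ½ · (const 1ℚ ⊖ Z ⊖ sqrtS D)
  zM≋N : Z ⊗ M1 ≋ N
  zM≋N = ≋-sym (Z⊗-divZ N refl)

M1-equation : M1 ≋ Z ⊕ Z ⊗ M1 ⊕ Z ⊗ (M1 ⊗ M1)
M1-equation = Z⊗-cancel M1 _ (≋-modulo
  (solve 2 (λ z M → z :* M := z :* (z :+ z :* M :+ z :* (M :* M))
                       :+ ((con 1ℚ :- z) :* (z :* M) :- (z :* z :+ (z :* M) :* (z :* M)))) ≋-refl Z M1)
  (≋0-⊖ zM-equation))

zM-equation-unique : ∀ {X} → X 0 ≡ 0ℚ → (1ₛ ⊖ Z) ⊗ X ≋ Z ⊗ Z ⊕ X ⊗ X → X ≋ Z ⊗ M1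
zM-equation-unique {X} X₀≡0 X-root =
  fixpoint-unique₁ contractive (fixpoint X₀≡0 X-root) (fixpoint (Z⊗-zero M1) zM-equation)
  where
  -- For X 0 = 0, X ⊗ X = z² (X/z)², and in the latter form the map is contractive.
  Φ : Series → Series
  Φ X = Z ⊗ Z ⊕ Z ⊗ X ⊕ Z ⊗ (Z ⊗ (divZ X ⊗ divZ X))
  fixpoint : ∀ {X} → X 0 ≡ 0ℚ → (1ₛ ⊖ Z) ⊗ X ≋ Z ⊗ Z ⊕ X ⊗ X → X ≋ Φ X
  fixpoint {X} X₀≡0 X-root = begin
    X                             ≈⟨ ≋-modulo (solve 2 (λ z X → X := z :* z :+ z :* X :+ X :* X
                                       :+ ((con 1ℚ :- z) :* X :- (z :* z :+ X :* X))) ≋-refl Z X) (≋0-⊖ X-root) ⟩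
    Z ⊗ Z ⊕ Z ⊗ X ⊕ X ⊗ X         ≈⟨ ⊕-cong (≋-refl {Z ⊗ Z ⊕ Z ⊗ X}) (⊗-cong X≋zdX X≋zdX) ⟩
    Z ⊗ Z ⊕ Z ⊗ X ⊕ (Z ⊗ divZ X) ⊗ (Z ⊗ divZ X)
                                  ≈⟨ solve 3 (λ z X d → z :* z :+ z :* X :+ (z :* d) :* (z :* d) :=
                                       z :* z :+ z :* X :+ z :* (z :* (d :* d))) ≋-refl Z X (divZ X) ⟩
    Φ X                           ∎
    where
    open ≋-Reasoning
    X≋zdX : X ≋ Z ⊗ divZ X
    X≋zdX = Z⊗-divZ X X₀≡0
  contractive : Contractive₁ Φ
  contractive n X Y X≈Y = ⊕-≈[] (⊕-≈[] (≋⇒≈[] (suc n) (≋-refl {Z ⊗ Z})) (Z⊗-≈[] X≈Y)) (Z⊗-≈[] (square n X≈Y))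
    where
    square : ∀ n → X ≈[ n ] Y → Z ⊗ (divZ X ⊗ divZ X) ≈[ n ] Z ⊗ (divZ Y ⊗ divZ Y)
    square zero    _   = λ _ ()
    square (suc n) X≈Y = Z⊗-≈[] (⊗-≈[] divZ≈ divZ≈)
      where
      divZ≈ : divZ X ≈[ n ] divZ Y
      divZ≈ m m<n = X≈Y (suc m) (s≤s m<n)

-- Counting open terms

Sized : ℕ → ℕ → Set
Sized k n = Σ (Term k) (λ t → size t ≡ n)

Fin-injective : ∀ {a b} → Fin a ↔ Fin b → a ≡ b
Fin-injective a↔b =
  FinP.cantor-schröder-bernstein (Injection.injective (↔⇒↣ a↔b)) (Injection.injective (↔⇒↣ (↔-sym a↔b)))

sumN : ℕ → (ℕ → ℕ) → ℕ
sumN zero    g = 0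
sumN (suc n) g = g 0 ℕ.+ sumN n (λ i → g (suc i))

Fin-sumN↔Σ : ∀ n g → Fin (sumN n g) ↔ Σ (Fin n) (λ i → Fin (g (toℕ i)))
Fin-sumN↔Σ zero    g = mk↔ₛ′ (λ ()) (λ ()) (λ ()) (λ ())
Fin-sumN↔Σ (suc n) g = ↔-trans FinP.+↔⊎ (↔-trans (↔-refl ⊎-↔ Fin-sumN↔Σ n (λ i → g (suc i))) split)
  where
  split : (Fin (g 0) ⊎ Σ (Fin n) (λ i → Fin (g (suc (toℕ i))))) ↔ Σ (Fin (suc n)) (λ i → Fin (g (toℕ i)))
  split = mk↔ₛ′ (λ { (inj₁ x) → Fin.zero , x ; (inj₂ (i , x)) → Fin.suc i , x })
                (λ { (Fin.zero , x) → inj₁ x ; (Fin.suc i , x) → inj₂ (i , x) })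
                (λ { (Fin.zero , x) → refl ; (Fin.suc i , x) → refl })
                (λ { (inj₁ x) → refl ; (inj₂ (i , x)) → refl })

variableCount : ℕ → ℕ → ℕ
variableCount k zero    = k
variableCount k (suc _) = 0

Variables : ℕ → ℕ → Set
Variables k m = Σ (Fin k) (λ _ → m ≡ 0)

Applications : ℕ → ℕ → Set
Applications k m = Σ (Term k × Term k) (λ (s , t) → size s ℕ.+ size t ≡ m)

Sized-suc↔ : ∀ k m → Sized k (suc m) ↔ (Variables k m ⊎ (Applications k m ⊎ Sized (suc k) m))
Sized-suc↔ k m = mk↔ₛ′ to from to∘from from∘to
  where
  to : Sized k (suc m) → Variables k m ⊎ (Applications k m ⊎ Sized (suc k) m)
  to (var x   , e) = inj₁ (x , sym (ℕP.suc-injective e))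
  to (app s t , e) = inj₂ (inj₁ ((s , t) , ℕP.suc-injective e))
  to (lam t   , e) = inj₂ (inj₂ (t , ℕP.suc-injective e))
  from : Variables k m ⊎ (Applications k m ⊎ Sized (suc k) m) → Sized k (suc m)
  from (inj₁ (x , e))                = var x , cong suc (sym e)
  from (inj₂ (inj₁ ((s , t) , e)))   = app s t , cong suc e
  from (inj₂ (inj₂ (t , e)))         = lam t , cong suc e
  to∘from : ∀ y → to (from y) ≡ y
  to∘from (inj₁ (x , e))              = cong (λ p → inj₁ (x , p)) (ℕP.≡-irrelevant _ _)
  to∘from (inj₂ (inj₁ ((s , t) , e))) = cong (λ p → inj₂ (inj₁ ((s , t) , p))) (ℕP.≡-irrelevant _ _)
  to∘from (inj₂ (inj₂ (t , e)))       = cong (λ p → inj₂ (inj₂ (t , p))) (ℕP.≡-irrelevant _ _)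
  from∘to : ∀ x → from (to x) ≡ x
  from∘to (var x   , e) = cong (var x ,_) (ℕP.≡-irrelevant _ _)
  from∘to (app s t , e) = cong (app s t ,_) (ℕP.≡-irrelevant _ _)
  from∘to (lam t   , e) = cong (lam t ,_) (ℕP.≡-irrelevant _ _)

Variables↔Fin : ∀ k m → Variables k m ↔ Fin (variableCount k m)
Variables↔Fin k zero    = mk↔ₛ′ proj₁ (_, refl) (λ _ → refl) (λ (x , e) → cong (x ,_) (ℕP.≡-irrelevant _ _))
Variables↔Fin k (suc m) = mk↔ₛ′ (λ ()) (λ ()) (λ ()) (λ ())

Applications↔Σ : ∀ k m → Applications k m ↔ Σ (Fin (suc m)) (λ i → Sized k (toℕ i) × Sized k (m ∸ toℕ i))
Applications↔Σ k m = mk↔ₛ′ to from to∘from from∘to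
  where
  size<1+m : ∀ (s t : Term k) → size s ℕ.+ size t ≡ m → size s < suc m
  size<1+m s t e = s≤s (subst (size s ≤_) e (ℕP.m≤m+n (size s) (size t)))
  to : Applications k m → Σ (Fin (suc m)) (λ i → Sized k (toℕ i) × Sized k (m ∸ toℕ i))
  to ((s , t) , e) = fromℕ< (size<1+m s t e)
                   , (s , sym (FinP.toℕ-fromℕ< (size<1+m s t e)))
                   , (t , trans (sym (ℕP.m+n∸m≡n (size s) (size t)))
                                (cong₂ _∸_ e (sym (FinP.toℕ-fromℕ< (size<1+m s t e)))))
  from : Σ (Fin (suc m)) (λ i → Sized k (toℕ i) × Sized k (m ∸ toℕ i)) → Applications k m
  from (i , (s , es) , (t , et)) = (s , t) , trans (cong₂ ℕ._+_ es et) (ℕP.m+[n∸m]≡n (ℕP.≤-pred (FinP.toℕ<n i)))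
  to∘from : ∀ y → to (from y) ≡ y
  to∘from (i , (s , es) , (t , et)) = same-index _ (FinP.toℕ-injective (trans (FinP.toℕ-fromℕ< _) es)) _ _
    where
    same-index : ∀ j → j ≡ i → (p : size s ≡ toℕ j) → (q : size t ≡ m ∸ toℕ j) →
                 (j , (s , p) , (t , q)) ≡ (i , (s , es) , (t , et))
    same-index j refl p q = cong₂ (λ a b → (i , (s , a) , (t , b))) (ℕP.≡-irrelevant p es) (ℕP.≡-irrelevant q et)
  from∘to : ∀ x → from (to x) ≡ x
  from∘to ((s , t) , e) = cong ((s , t) ,_) (ℕP.≡-irrelevant _ _)

Sized-suc-card : ∀ k m (c : ℕ → ℕ) (d : ℕ) → (∀ i → i ≤ m → Fin (c i) ↔ Sized k i) → Fin d ↔ Sized (suc k) m →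
  Fin (variableCount k m ℕ.+ (sumN (suc m) (λ i → c i ℕ.* c (m ∸ i)) ℕ.+ d)) ↔ Sized k (suc m)
Sized-suc-card k m c d c↔ d↔ =
  ↔-trans FinP.+↔⊎ (↔-trans (↔-sym (Variables↔Fin k m) ⊎-↔ ↔-trans FinP.+↔⊎ (applications ⊎-↔ d↔))
                           (↔-sym (Sized-suc↔ k m)))
  where
  applications : Fin (sumN (suc m) (λ i → c i ℕ.* c (m ∸ i))) ↔ Applications k m
  applications = ↔-trans (Fin-sumN↔Σ (suc m) (λ i → c i ℕ.* c (m ∸ i))) (↔-trans
    (Σ-↔ ↔-refl (λ {i} → ↔-trans FinP.*↔×
      (c↔ (toℕ i) (ℕP.≤-pred (FinP.toℕ<n i)) ×-↔ c↔ (m ∸ toℕ i) (ℕP.m∸n≤m m (toℕ i)))))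
    (↔-sym (Applications↔Σ k m)))

-- The first argument is fuel (any bound above the size); it only makes the recursion structural.
countBelow : ℕ → ℕ → ℕ → ℕ
countBelow zero    k n       = 0
countBelow (suc f) k zero    = 0
countBelow (suc f) k (suc m) =
  variableCount k m ℕ.+ (sumN (suc m) (λ i → countBelow f k i ℕ.* countBelow f k (m ∸ i)) ℕ.+ countBelow f (suc k) m)

countBelow↔ : ∀ f k n → n < f → Fin (countBelow f k n) ↔ Sized k n
countBelow↔ (suc f) k zero    _         = mk↔ₛ′ (λ ()) (λ (t , e) → ⊥-elim (size≢0 t e))
                                                (λ (t , e) → ⊥-elim (size≢0 t e)) (λ ())
  where
  size≢0 : ∀ {k} (t : Term k) → size t ≢ 0
  size≢0 (var _)   ()
  size≢0 (app _ _) ()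
  size≢0 (lam _)   ()
countBelow↔ (suc f) k (suc m) (s≤s m<f) = Sized-suc-card k m (countBelow f k) (countBelow f (suc k) m)
  (λ i i≤m → countBelow↔ f k i (ℕP.≤-<-trans i≤m m<f)) (countBelow↔ f (suc k) m m<f)

count : ℕ → ℕ → ℕ
count k n = countBelow (suc n) k n

count↔ : ∀ k n → Fin (count k n) ↔ Sized k n
count↔ k n = countBelow↔ (suc n) k n ℕP.≤-refl

count-suc : ∀ k m →
  count k (suc m) ≡ variableCount k m ℕ.+ (sumN (suc m) (λ i → count k i ℕ.* count k (m ∸ i)) ℕ.+ count (suc k) m)
count-suc k m = Fin-injective (↔-trans (count↔ k (suc m))
  (↔-sym (Sized-suc-card k m (count k) (count (suc k) m) (λ i _ → count↔ k i) (count↔ (suc k) m))))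

toℚᵘ-fromℕ : ∀ n → ℚ.toℚᵘ (fromℕ n) ℚᵘ.≃ ℚᵘ.mkℚᵘ (ℤ.+ n) 0
toℚᵘ-fromℕ n = ℚP.toℚᵘ-fromℚᵘ (ℚᵘ.mkℚᵘ (ℤ.+ n) 0)

fromℕ-+ : ∀ a b → fromℕ (a ℕ.+ b) ≡ fromℕ a + fromℕ b
fromℕ-+ a b = ℚP.toℚᵘ-injective (begin
  ℚ.toℚᵘ (fromℕ (a ℕ.+ b))                          ≈⟨ toℚᵘ-fromℕ (a ℕ.+ b) ⟩
  ℚᵘ.mkℚᵘ (ℤ.+ (a ℕ.+ b)) 0                         ≈⟨ ℚᵘ.*≡* (cong (ℤ._* ℤ.+ 1) numerator) ⟩
  ℚᵘ.mkℚᵘ (ℤ.+ a) 0 ℚᵘ.+ ℚᵘ.mkℚᵘ (ℤ.+ b) 0          ≈⟨ ℚᵘP.+-cong (toℚᵘ-fromℕ a) (toℚᵘ-fromℕ b) ⟨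
  ℚ.toℚᵘ (fromℕ a) ℚᵘ.+ ℚ.toℚᵘ (fromℕ b)            ≈⟨ ℚP.toℚᵘ-homo-+ (fromℕ a) (fromℕ b) ⟨
  ℚ.toℚᵘ (fromℕ a + fromℕ b)                        ∎)
  where
  open ℚᵘP.≃-Reasoning
  numerator : ℤ.+ (a ℕ.+ b) ≡ ℤ.+ a ℤ.* ℤ.+ 1 ℤ.+ ℤ.+ b ℤ.* ℤ.+ 1
  numerator = trans (ℤP.pos-+ a b) (sym (cong₂ ℤ._+_ (ℤP.*-identityʳ (ℤ.+ a)) (ℤP.*-identityʳ (ℤ.+ b))))

fromℕ-* : ∀ a b → fromℕ (a ℕ.* b) ≡ fromℕ a * fromℕ b
fromℕ-* a b = ℚP.toℚᵘ-injective (begin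
  ℚ.toℚᵘ (fromℕ (a ℕ.* b))                          ≈⟨ toℚᵘ-fromℕ (a ℕ.* b) ⟩
  ℚᵘ.mkℚᵘ (ℤ.+ (a ℕ.* b)) 0                         ≈⟨ ℚᵘ.*≡* (cong (ℤ._* ℤ.+ 1) (ℤP.pos-* a b)) ⟩
  ℚᵘ.mkℚᵘ (ℤ.+ a) 0 ℚᵘ.* ℚᵘ.mkℚᵘ (ℤ.+ b) 0          ≈⟨ ℚᵘP.*-cong (toℚᵘ-fromℕ a) (toℚᵘ-fromℕ b) ⟨
  ℚ.toℚᵘ (fromℕ a) ℚᵘ.* ℚ.toℚᵘ (fromℕ b)            ≈⟨ ℚP.toℚᵘ-homo-* (fromℕ a) (fromℕ b) ⟨
  ℚ.toℚᵘ (fromℕ a * fromℕ b)                        ∎)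
  where open ℚᵘP.≃-Reasoning

fromℕ-sumN : ∀ n g → fromℕ (sumN n g) ≡ sumTo n (λ i → fromℕ (g i))
fromℕ-sumN zero    g = refl
fromℕ-sumN (suc n) g =
  trans (fromℕ-+ (g 0) (sumN n (λ i → g (suc i))))
        (trans (cong (fromℕ (g 0) +_) (fromℕ-sumN n (λ i → g (suc i)))) (sym (sumTo-unfoldˡ n (λ i → fromℕ (g i)))))

termsGF : ℕ → Series
termsGF k n = fromℕ (count k n)

termsGF-equation : ∀ k → termsGF k ≋ fromℕ k · Z ⊕ Z ⊗ (termsGF k ⊗ termsGF k) ⊕ Z ⊗ termsGF (suc k)
termsGF-equation k zero    = sym (cong₂ _+_ (cong₂ _+_ (ℚP.*-zeroʳ (fromℕ k)) (Z⊗-zero (termsGF k ⊗ termsGF k)))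
                                           (Z⊗-zero (termsGF (suc k))))
termsGF-equation k (suc m) = begin
    fromℕ (count k (suc m))
  ≡⟨ cong fromℕ (count-suc k m) ⟩
    fromℕ (variableCount k m ℕ.+ (applications ℕ.+ count (suc k) m))
  ≡⟨ fromℕ-+ (variableCount k m) _ ⟩
    fromℕ (variableCount k m) + fromℕ (applications ℕ.+ count (suc k) m)
  ≡⟨ cong (fromℕ (variableCount k m) +_) (fromℕ-+ applications (count (suc k) m)) ⟩
    fromℕ (variableCount k m) + (fromℕ applications + termsGF (suc k) m)
  ≡⟨ sym (ℚP.+-assoc (fromℕ (variableCount k m)) (fromℕ applications) (termsGF (suc k) m)) ⟩
    fromℕ (variableCount k m) + fromℕ applications + termsGF (suc k) m
  ≡⟨ cong₂ _+_ (cong₂ _+_ (variables m) (sym applications≡)) (sym (Z⊗-suc (termsGF (suc k)) m)) ⟩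
    (fromℕ k · Z ⊕ Z ⊗ (termsGF k ⊗ termsGF k) ⊕ Z ⊗ termsGF (suc k)) (suc m) ∎
  where
  open ≡-Reasoning
  applications : ℕ
  applications = sumN (suc m) (λ i → count k i ℕ.* count k (m ∸ i))
  variables : ∀ m → fromℕ (variableCount k m) ≡ fromℕ k * Z (suc m)
  variables zero    = sym (ℚP.*-identityʳ (fromℕ k))
  variables (suc m) = sym (ℚP.*-zeroʳ (fromℕ k))
  applications≡ : (Z ⊗ (termsGF k ⊗ termsGF k)) (suc m) ≡ fromℕ applications
  applications≡ = trans (Z⊗-suc (termsGF k ⊗ termsGF k) m)
    (sym (trans (fromℕ-sumN (suc m) (λ i → count k i ℕ.* count k (m ∸ i)))
                (sumTo-cong (suc m) (λ i → fromℕ-* (count k i) (count k (m ∸ i))))))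

-- The functional equations

z/[1-2zM] : Series
z/[1-2zM] = z/ (const 1ℚ ⊖ fromℕ 2 · (Z ⊗ M1))

z/[1-2zM]-equation : z/[1-2zM] ⊗ (1ₛ ⊖ const (fromℕ 2) ⊗ (Z ⊗ M1)) ≋ Z
z/[1-2zM]-equation = ≋-trans (⊗-cong (≋-refl {z/[1-2zM]}) (⊖-cong (≋-refl {1ₛ}) (const-⊗ (fromℕ 2) (Z ⊗ M1))))
                             (z/-⊗ _ refl)

termsGF-∘z/[1-2zM] : ∀ k → let A = termsGF k ∘ₛ z/[1-2zM] in
  A ≋ const (fromℕ k) ⊗ z/[1-2zM] ⊕ z/[1-2zM] ⊗ (A ⊗ A) ⊕ z/[1-2zM] ⊗ (termsGF (suc k) ∘ₛ z/[1-2zM])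
termsGF-∘z/[1-2zM] k = begin
  T ∘ₛ W                                         ≈⟨ ∘ₛ-cong (termsGF-equation k) (≋-refl {W}) ⟩
  (fromℕ k · Z ⊕ Z ⊗ (T ⊗ T) ⊕ Z ⊗ T′) ∘ₛ W      ≈⟨ ⊕-∘ₛ (fromℕ k · Z ⊕ Z ⊗ (T ⊗ T)) (Z ⊗ T′) W ⟩
  (fromℕ k · Z ⊕ Z ⊗ (T ⊗ T)) ∘ₛ W ⊕ (Z ⊗ T′) ∘ₛ W
    ≈⟨ ⊕-cong (⊕-∘ₛ (fromℕ k · Z) (Z ⊗ (T ⊗ T)) W) (≋-refl {(Z ⊗ T′) ∘ₛ W}) ⟩
  (fromℕ k · Z) ∘ₛ W ⊕ (Z ⊗ (T ⊗ T)) ∘ₛ W ⊕ (Z ⊗ T′) ∘ₛ W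
    ≈⟨ ⊕-cong (⊕-cong variables applications) (Z⊗-∘ₛ T′ W W₀≡0) ⟩
  const (fromℕ k) ⊗ W ⊕ W ⊗ ((T ∘ₛ W) ⊗ (T ∘ₛ W)) ⊕ W ⊗ (T′ ∘ₛ W) ∎
  where
  open ≋-Reasoning
  T T′ W : Series
  T  = termsGF k
  T′ = termsGF (suc k)
  W  = z/[1-2zM]
  W₀≡0 : W 0 ≡ 0ℚ
  W₀≡0 = z/-zero (const 1ℚ ⊖ fromℕ 2 · (Z ⊗ M1))
  variables : (fromℕ k · Z) ∘ₛ W ≋ const (fromℕ k) ⊗ W
  variables = ≋-trans (·-∘ₛ (fromℕ k) Z W)
                      (≋-trans (·-cong (fromℕ k) (Z-∘ₛ W W₀≡0)) (≋-sym (const-⊗ (fromℕ k) W)))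
  applications : (Z ⊗ (T ⊗ T)) ∘ₛ W ≋ W ⊗ ((T ∘ₛ W) ⊗ (T ∘ₛ W))
  applications = ≋-trans (Z⊗-∘ₛ (T ⊗ T) W W₀≡0) (⊗-cong (≋-refl {W}) (⊗-∘ₛ T T W W₀≡0))

shifted-equation : ∀ {A B W M z} c →
  A ≋ c ⊗ W ⊕ W ⊗ (A ⊗ A) ⊕ W ⊗ B →
  M ≋ z ⊕ z ⊗ M ⊕ z ⊗ (M ⊗ M) →
  W ⊗ (1ₛ ⊖ const (fromℕ 2) ⊗ (z ⊗ M)) ≋ z →
  M ⊕ A ≋ (1ₛ ⊕ c) ⊗ z ⊕ z ⊗ ((M ⊕ A) ⊗ (M ⊕ A)) ⊕ z ⊗ (M ⊕ B)
shifted-equation {A} {B} {W} {M} {z} c A-eq M-eq W-eq = ≋-modulo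
  (solve 6 (λ A B W M z c → M :+ A := (con 1ℚ :+ c) :* z :+ z :* ((M :+ A) :* (M :+ A)) :+ z :* (M :+ B)
      :+ ((M :- (z :+ z :* M :+ z :* (M :* M)))
      :+ (con 1ℚ :- con (fromℕ 2) :* z :* M) :* (A :- (c :* W :+ W :* (A :* A) :+ W :* B))
      :+ (W :* (con 1ℚ :- con (fromℕ 2) :* (z :* M)) :- z) :* (c :+ A :* A :+ B))) ≋-refl A B W M z c)
  (≋0-⊕ (≋0-⊕ (≋0-⊖ M-eq) (≋0-⊗ˡ (1ₛ ⊖ const (fromℕ 2) ⊗ z ⊗ M) (≋0-⊖ A-eq)))
        (≋0-⊗ʳ (c ⊕ A ⊗ A ⊕ B) (≋0-⊖ W-eq)))

termsGF-suc : ∀ k → termsGF (suc k) ≋ M1 ⊕ termsGF k ∘ₛ z/[1-2zM]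
termsGF-suc = fixpoint-unique contractive (λ k → termsGF-equation (suc k)) shifted
  where
  Φ : (ℕ → Series) → (ℕ → Series)
  Φ X k = fromℕ (suc k) · Z ⊕ Z ⊗ (X k ⊗ X k) ⊕ Z ⊗ X (suc k)
  contractive : Contractive Φ
  contractive n X Y X≈Y k =
    ⊕-≈[] (⊕-≈[] (≋⇒≈[] (suc n) (≋-refl {fromℕ (suc k) · Z})) (Z⊗-≈[] (⊗-≈[] (X≈Y k) (X≈Y k)))) (Z⊗-≈[] (X≈Y (suc k)))
  1+k·Z : ∀ k → (1ₛ ⊕ const (fromℕ k)) ⊗ Z ≋ fromℕ (suc k) · Z
  1+k·Z k = ≋-trans (⊗-cong 1+k≋ (≋-refl {Z})) (≋-trans (const-⊗ (1ℚ + fromℕ k) Z)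
                    (·-cong′ (sym (fromℕ-+ 1 k))))
    where
    1+k≋ : 1ₛ ⊕ const (fromℕ k) ≋ const (1ℚ + fromℕ k)
    1+k≋ zero    = refl
    1+k≋ (suc n) = ℚP.+-identityˡ 0ℚ
    ·-cong′ : ∀ {a b} → a ≡ b → a · Z ≋ b · Z
    ·-cong′ a≡b n = cong (_* Z n) a≡b
  shifted : ∀ k → M1 ⊕ termsGF k ∘ₛ z/[1-2zM] ≋ Φ (λ k → M1 ⊕ termsGF k ∘ₛ z/[1-2zM]) k
  shifted k = ≋-trans
    (shifted-equation {B = termsGF (suc k) ∘ₛ z/[1-2zM]} {z/[1-2zM]} {M1} {Z} (const (fromℕ k))
                      (termsGF-∘z/[1-2zM] k) M1-equation z/[1-2zM]-equation)
    (⊕-cong (⊕-cong (1+k·Z k) ≋-refl) ≋-refl)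

LambdaGF-equation : ∀ lamCount → (∀ n → Fin (lamCount n) ↔ ClosedOfSize n) →
  let Λ = LambdaGF lamCount in Λ ≋ Z ⊗ M1 ⊕ Z ⊗ (Λ ⊗ Λ) ⊕ Z ⊗ (Λ ∘ₛ z/[1-2zM])
LambdaGF-equation lamCount lamCount↔ = begin
  Λ                                             ≈⟨ Λ≋T₀ ⟩
  termsGF 0                                     ≈⟨ termsGF-equation 0 ⟩
  fromℕ 0 · Z ⊕ Z ⊗ (termsGF 0 ⊗ termsGF 0) ⊕ Z ⊗ termsGF 1
    ≈⟨ ⊕-cong (⊕-cong 0·Z≋0 (⊗-cong (≋-refl {Z}) (⊗-cong (≋-sym Λ≋T₀) (≋-sym Λ≋T₀))))
              (⊗-cong (≋-refl {Z}) (≋-trans (termsGF-suc 0) (⊕-cong (≋-refl {M1}) (∘ₛ-cong (≋-sym Λ≋T₀) ≋-refl)))) ⟩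
  0ₛ ⊕ Z ⊗ (Λ ⊗ Λ) ⊕ Z ⊗ (M1 ⊕ Λ ∘ₛ W)         ≈⟨ solve 4 (λ Λ z M L → con 0ℚ :+ z :* (Λ :* Λ) :+ z :* (M :+ L) :=
                                                     z :* M :+ z :* (Λ :* Λ) :+ z :* L) ≋-refl Λ Z M1 (Λ ∘ₛ W) ⟩
  Z ⊗ M1 ⊕ Z ⊗ (Λ ⊗ Λ) ⊕ Z ⊗ (Λ ∘ₛ W)           ∎
  where
  open ≋-Reasoning
  Λ W : Series
  Λ = LambdaGF lamCount
  W = z/[1-2zM]
  Λ≋T₀ : Λ ≋ termsGF 0
  Λ≋T₀ zero    = refl
  Λ≋T₀ (suc n) = cong fromℕ (Fin-injective (↔-trans (lamCount↔ (suc n)) (↔-sym (count↔ 0 (suc n)))))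
  0·Z≋0 : fromℕ 0 · Z ≋ 0ₛ
  0·Z≋0 n = trans (ℚP.*-zeroˡ (Z n)) (sym (const-0ℚ n))

LambdaEquation : Series → Series
LambdaEquation X = Z ⊗ M1 ⊕ Z ⊗ (X ⊗ X) ⊕ Z ⊗ (X ∘ₛ z/[1-2zM])

LambdaEquation-unique : ∀ {X Y} → X ≋ LambdaEquation X → Y ≋ LambdaEquation Y → X ≋ Y
LambdaEquation-unique = fixpoint-unique₁ λ n X Y X≈Y →
  ⊕-≈[] (⊕-≈[] (≋⇒≈[] (suc n) (≋-refl {Z ⊗ M1})) (Z⊗-≈[] (⊗-≈[] X≈Y X≈Y))) (Z⊗-≈[] (∘ₛ-≈[] z/[1-2zM] X≈Y))

z/[1-z] : Series
z/[1-z] = z/ (const 1ℚ ⊖ Z)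

z/[1-z]-equation : z/[1-z] ⊗ (1ₛ ⊖ Z) ≋ Z
z/[1-z]-equation = z/-⊗ (const 1ℚ ⊖ Z) refl

z/[1-z]-zero : z/[1-z] 0 ≡ 0ℚ
z/[1-z]-zero = z/-zero (const 1ℚ ⊖ Z)

[1-z]⊗Cz∘z/[1-z] : (1ₛ ⊖ Z) ⊗ (Cz ∘ₛ z/[1-z]) ≋ Z ⊗ M1
[1-z]⊗Cz∘z/[1-z] = zM-equation-unique X₀≡0 (≋-modulo
  (solve 3 (λ Y V z → (con 1ℚ :- z) :* ((con 1ℚ :- z) :* Y) :=
        z :* z :+ ((con 1ℚ :- z) :* Y) :* ((con 1ℚ :- z) :* Y)
        :+ ((con 1ℚ :- z) :* (con 1ℚ :- z) :* (Y :- (V :* V :+ Y :* Y))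
        :+ (V :* (con 1ℚ :- z) :- z) :* (V :* (con 1ℚ :- z) :+ z)))
    ≋-refl Y V Z)
  (≋0-⊕ (≋0-⊗ˡ ((1ₛ ⊖ Z) ⊗ (1ₛ ⊖ Z)) (≋0-⊖ Y-equation)) (≋0-⊗ʳ (V ⊗ (1ₛ ⊖ Z) ⊕ Z) (≋0-⊖ z/[1-z]-equation))))
  where
  V Y : Series
  V = z/[1-z]
  Y = Cz ∘ₛ V
  X₀≡0 : ((1ₛ ⊖ Z) ⊗ Y) 0 ≡ 0ℚ
  X₀≡0 = cong (λ y → 0ℚ + (1ℚ - 0ℚ) * y) (∘ₛ-zero Cz V)
  Y-equation : Y ≋ V ⊗ V ⊕ Y ⊗ Y
  Y-equation = begin
    Cz ∘ₛ V                         ≈⟨ ∘ₛ-cong Cz-equation (≋-refl {V}) ⟩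
    (Z ⊗ Z ⊕ Cz ⊗ Cz) ∘ₛ V          ≈⟨ ⊕-∘ₛ (Z ⊗ Z) (Cz ⊗ Cz) V ⟩
    (Z ⊗ Z) ∘ₛ V ⊕ (Cz ⊗ Cz) ∘ₛ V   ≈⟨ ⊕-cong (≋-trans (⊗-∘ₛ Z Z V z/[1-z]-zero)
                                                       (⊗-cong (Z-∘ₛ V z/[1-z]-zero) (Z-∘ₛ V z/[1-z]-zero)))
                                              (⊗-∘ₛ Cz Cz V z/[1-z]-zero) ⟩
    V ⊗ V ⊕ Y ⊗ Y                   ∎
    where open ≋-Reasoning

z/[1-2C] : Series
z/[1-2C] = z/ (const 1ℚ ⊖ fromℕ 2 · Cz)

z/[1-2C]∘z/[1-z] : z/[1-2C] ∘ₛ z/[1-z] ≋ z/[1-z] ∘ₛ z/[1-2zM]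
z/[1-2C]∘z/[1-z] = ⊗-cancelʳ-unit Q refl (≋-trans left (≋-sym right))
  where
  two : ℚ
  two = fromℕ 2
  V W N Q : Series
  V = z/[1-z]
  W = z/[1-2zM]
  N = Z ⊗ M1
  Q = 1ₛ ⊖ Z ⊖ const two ⊗ N
  P : Series
  P = recip (const 1ℚ ⊖ two · Cz) ∘ₛ V
  P-equation : P ⊗ (1ₛ ⊖ const two ⊗ (Cz ∘ₛ V)) ≋ 1ₛ
  P-equation = ≋-trans (⊗-cong (≋-refl {P}) (≋-sym denominator∘V)) (recip-∘ₛ _ V refl z/[1-z]-zero)
    where
    denominator∘V : (const 1ℚ ⊖ two · Cz) ∘ₛ V ≋ 1ₛ ⊖ const two ⊗ (Cz ∘ₛ V)
    denominator∘V = ≋-trans (⊖-∘ₛ 1ₛ (two · Cz) V)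
      (⊖-cong (const-∘ₛ 1ℚ V) (≋-trans (·-∘ₛ two Cz V) (≋-sym (const-⊗ two (Cz ∘ₛ V)))))
  left : (z/[1-2C] ∘ₛ V) ⊗ Q ≋ Z
  left = ≋-trans (⊗-cong (Z⊗-∘ₛ (recip (const 1ℚ ⊖ two · Cz)) V z/[1-z]-zero) (≋-refl {Q})) (≋-modulo
    (solve 5 (λ P Y V N z → (V :* P) :* (con 1ℚ :- z :- con two :* N) :=
        z :+ (V :* (con 1ℚ :- z) :* (P :* (con 1ℚ :- con two :* Y) :- con 1ℚ) :+ (V :* (con 1ℚ :- z) :- z)
        :+ con two :* V :* P :* ((con 1ℚ :- z) :* Y :- N))) ≋-refl P (Cz ∘ₛ V) V N Z)
    (≋0-⊕ (≋0-⊕ (≋0-⊗ˡ (V ⊗ (1ₛ ⊖ Z)) (≋0-⊖ P-equation)) (≋0-⊖ z/[1-z]-equation))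
          (≋0-⊗ˡ (const two ⊗ V ⊗ P) (≋0-⊖ [1-z]⊗Cz∘z/[1-z]))))
  S : Series
  S = recip (const 1ℚ ⊖ Z) ∘ₛ W
  S-equation : S ⊗ (1ₛ ⊖ W) ≋ 1ₛ
  S-equation = ≋-trans (⊗-cong (≋-refl {S}) (≋-sym denominator∘W)) (recip-∘ₛ _ W refl W₀≡0)
    where
    W₀≡0 : W 0 ≡ 0ℚ
    W₀≡0 = z/-zero (const 1ℚ ⊖ two · N)
    denominator∘W : (const 1ℚ ⊖ Z) ∘ₛ W ≋ 1ₛ ⊖ W
    denominator∘W = ≋-trans (⊖-∘ₛ 1ₛ Z W) (⊖-cong (const-∘ₛ 1ℚ W) (Z-∘ₛ W W₀≡0))
  right : (V ∘ₛ W) ⊗ Q ≋ Z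
  right = ≋-trans (⊗-cong (Z⊗-∘ₛ (recip (const 1ℚ ⊖ Z)) W (z/-zero (const 1ℚ ⊖ two · N))) (≋-refl {Q})) (≋-modulo
    (solve 4 (λ S W N z → (W :* S) :* (con 1ℚ :- z :- con two :* N) :=
        z :+ (z :* (S :* (con 1ℚ :- W) :- con 1ℚ) :+ S :* (W :* (con 1ℚ :- con two :* N) :- z))) ≋-refl S W N Z)
    (≋0-⊕ (≋0-⊗ˡ Z (≋0-⊖ S-equation)) (≋0-⊗ˡ S (≋0-⊖ z/[1-2zM]-equation))))

LambdaTilde∘z/[1-z] : ∀ Lt → IsLambdaTilde Lt → Lt ∘ₛ z/[1-z] ≋ LambdaEquation (Lt ∘ₛ z/[1-z])
LambdaTilde∘z/[1-z] Lt Lt-equation = ≋-modulo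
  (solve 6 (λ L Y V K N z → L := N :+ z :* (L :* L) :+ z :* K
      :+ ((con 1ℚ :- z) :* (L :- (Y :+ V :* (L :* L) :+ V :* K :- V :* L)) :+ ((con 1ℚ :- z) :* Y :- N)
      :+ (V :* (con 1ℚ :- z) :- z) :* (L :* L :+ K :- L))) ≋-refl L (Cz ∘ₛ V) V K (Z ⊗ M1) Z)
  (≋0-⊕ (≋0-⊕ (≋0-⊗ˡ (1ₛ ⊖ Z) (≋0-⊖ L-equation)) (≋0-⊖ [1-z]⊗Cz∘z/[1-z]))
        (≋0-⊗ʳ (L ⊗ L ⊕ K ⊖ L) (≋0-⊖ z/[1-z]-equation)))
  where
  V L K : Series
  V = z/[1-z]
  L = Lt ∘ₛ V
  K = L ∘ₛ z/[1-2zM]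
  V₀≡0 : V 0 ≡ 0ℚ
  V₀≡0 = z/[1-z]-zero
  K≋ : (Lt ∘ₛ z/[1-2C]) ∘ₛ V ≋ K
  K≋ = ≋-trans (∘ₛ-assoc Lt z/[1-2C] V (z/-zero (const 1ℚ ⊖ fromℕ 2 · Cz)) V₀≡0)
               (≋-trans (∘ₛ-cong (≋-refl {Lt}) z/[1-2C]∘z/[1-z])
                        (≋-sym (∘ₛ-assoc Lt V z/[1-2zM] V₀≡0 (z/-zero (const 1ℚ ⊖ fromℕ 2 · (Z ⊗ M1))))))
  L-equation : L ≋ Cz ∘ₛ V ⊕ V ⊗ (L ⊗ L) ⊕ V ⊗ K ⊖ V ⊗ L
  L-equation = begin
    Lt ∘ₛ V
      ≈⟨ ∘ₛ-cong Lt-equation (≋-refl {V}) ⟩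
    (Cz ⊕ Z ⊗ (Lt ⊗ Lt) ⊕ Z ⊗ (Lt ∘ₛ z/[1-2C]) ⊖ Z ⊗ Lt) ∘ₛ V
      ≈⟨ ⊖-∘ₛ (Cz ⊕ Z ⊗ (Lt ⊗ Lt) ⊕ Z ⊗ (Lt ∘ₛ z/[1-2C])) (Z ⊗ Lt) V ⟩
    (Cz ⊕ Z ⊗ (Lt ⊗ Lt) ⊕ Z ⊗ (Lt ∘ₛ z/[1-2C])) ∘ₛ V ⊖ (Z ⊗ Lt) ∘ₛ V
      ≈⟨ ⊖-cong (≋-trans (⊕-∘ₛ (Cz ⊕ Z ⊗ (Lt ⊗ Lt)) (Z ⊗ (Lt ∘ₛ z/[1-2C])) V)
                         (⊕-cong (⊕-∘ₛ Cz (Z ⊗ (Lt ⊗ Lt)) V) (≋-refl {(Z ⊗ (Lt ∘ₛ z/[1-2C])) ∘ₛ V})))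
                (≋-refl {(Z ⊗ Lt) ∘ₛ V}) ⟩
    Cz ∘ₛ V ⊕ (Z ⊗ (Lt ⊗ Lt)) ∘ₛ V ⊕ (Z ⊗ (Lt ∘ₛ z/[1-2C])) ∘ₛ V ⊖ (Z ⊗ Lt) ∘ₛ V
      ≈⟨ ⊖-cong (⊕-cong (⊕-cong (≋-refl {Cz ∘ₛ V})
                                (≋-trans (Z⊗-∘ₛ (Lt ⊗ Lt) V V₀≡0) (⊗-cong (≋-refl {V}) (⊗-∘ₛ Lt Lt V V₀≡0))))
                        (≋-trans (Z⊗-∘ₛ (Lt ∘ₛ z/[1-2C]) V V₀≡0) (⊗-cong (≋-refl {V}) K≋)))
                (Z⊗-∘ₛ Lt V V₀≡0) ⟩
    Cz ∘ₛ V ⊕ V ⊗ (L ⊗ L) ⊕ V ⊗ K ⊖ V ⊗ L ∎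
    where open ≋-Reasoning

proposition5 : (lamCount : ℕ → ℕ)
  → (∀ n → Fin (lamCount n) ↔ ClosedOfSize n)
  → (Lt : Series) → IsLambdaTilde Lt
  → (LambdaGF lamCount ≋ Lt ∘ₛ (Z ⊗ recip (const 1ℚ ⊖ Z)))
    × (LambdaGF lamCount ≋ Z ⊗ M1
                           ⊕ Z ⊗ (LambdaGF lamCount ⊗ LambdaGF lamCount)
                           ⊕ Z ⊗ (LambdaGF lamCount ∘ₛ
                                    (Z ⊗ recip (const 1ℚ ⊖ (fromℕ 2 · (Z ⊗ M1))))))
proposition5 lamCount lamCount↔ Lt Lt-equation =
  LambdaEquation-unique Λ-equation (LambdaTilde∘z/[1-z] Lt Lt-equation) , Λ-equation
  where
  Λ-equation : LambdaGF lamCount ≋ LambdaEquation (LambdaGF lamCount)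
  Λ-equation = LambdaGF-equation lamCount lamCount↔
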